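{- Let $L$ be either of the sequent calculi $\mathrm{lTS4}$ or $\mathrm{gTS4}$ defined in the context. Then the rule (cut) is admissible in cut-free $L$; that is, every sequent provable in $L$ is provable in $L$ without using (cut).
   Context: Formulas are built from countably many propositional variables using the binary connectives $\wedge,\vee,\to$ and the unary connectives $\neg,\Box,\Diamond$. Letters $\Gamma,\Delta$ (possibly with subscripts) denote finite, possibly empty, sets of formulas; a sequent is an expression $\Gamma\Rightarrow\Delta$; a comma denotes union. For a word $w$ over $\{\neg,\Box,\Diamond\}$, $w\Gamma=\{w\gamma:\gamma\in\Gamma\}$. A rule "$S_1;\dots;S_n\,/\,S$" has premises $S_1,\dots,S_n$ and conclusion $S$. "Cut-free $L$" means the system $L$ with the rule (cut) removed. A rule $R$ is admissible in a calculus $M$ if for every instance of $R$ with premises $S_1,\dots,S_n$ and conclusion $S$, whenever every $S_i$ is provable in $M$, $S$ is provable in $M$. The calculus lTS4. Initial sequents: for every propositional variable $p$: $p\Rightarrow p$, $\neg p\Rightarrow\neg p$, $\neg p,p\Rightarrow$, and $\Rightarrow\neg p,p$. Structural rules: (cut) $\Gamma\Rightarrow\alpha$; $\alpha,\Gamma\Rightarrow\Delta$ / $\Gamma\Rightarrow\Delta$. (we-left) $\Gamma\Rightarrow\Delta$ / $\alpha,\Gamma\Rightarrow\Delta$. (we-right) $\Gamma\Rightarrow\Delta$ / $\Gamma\Rightarrow\Delta,\alpha$. Non-twist logical rules: ($\wedge$left) $\alpha,\beta,\Gamma\Rightarrow\Delta$ / $\alpha\wedge\beta,\Gamma\Rightarrow\Delta$.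 ($\wedge$right) $\Gamma\Rightarrow\Delta,\alpha$; $\Gamma\Rightarrow\Delta,\beta$ / $\Gamma\Rightarrow\Delta,\alpha\wedge\beta$. ($\vee$left) $\alpha,\Gamma\Rightarrow\Delta$; $\beta,\Gamma\Rightarrow\Delta$ / $\alpha\vee\beta,\Gamma\Rightarrow\Delta$. ($\vee$right) $\Gamma\Rightarrow\Delta,\alpha,\beta$ / $\Gamma\Rightarrow\Delta,\alpha\vee\beta$. ($\to$left) $\Gamma\Rightarrow\Delta,\alpha$; $\beta,\Gamma\Rightarrow\Delta$ / $\alpha\to\beta,\Gamma\Rightarrow\Delta$. ($\to$right) $\alpha,\Gamma\Rightarrow\Delta,\beta$ / $\Gamma\Rightarrow\Delta,\alpha\to\beta$. ($\Box$left) $\alpha,\Gamma\Rightarrow\Delta$ / $\Box\alpha,\Gamma\Rightarrow\Delta$. ($\Box$right) $\Box\Gamma_1,\neg\Diamond\Gamma_2\Rightarrow\Diamond\Delta_1,\neg\Box\Delta_2,\alpha$ / $\Box\Gamma_1,\neg\Diamond\Gamma_2\Rightarrow\Diamond\Delta_1,\neg\Box\Delta_2,\Box\alpha$. ($\Diamond$left) $\alpha,\Box\Gamma_1,\neg\Diamond\Gamma_2\Rightarrow\Diamond\Delta_1,\neg\Box\Delta_2$ / $\Diamond\alpha,\Box\Gamma_1,\neg\Diamond\Gamma_2\Rightarrow\Diamond\Delta_1,\neg\Box\Delta_2$. ($\Diamond$right) $\Gamma\Rightarrow\Delta,\alpha$ / $\Gamma\Rightarrow\Delta,\Diamond\alpha$.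 Twist rules: ($\neg\neg$left$^t$) $\alpha,\Gamma\Rightarrow\Delta$ / $\neg\neg\alpha,\Gamma\Rightarrow\Delta$. ($\neg\neg$right$^t$) $\Gamma\Rightarrow\Delta,\alpha$ / $\Gamma\Rightarrow\Delta,\neg\neg\alpha$. ($\neg\wedge$left$^t$) $\Gamma\Rightarrow\Delta,\alpha$; $\Gamma\Rightarrow\Delta,\beta$ / $\neg(\alpha\wedge\beta),\Gamma\Rightarrow\Delta$. ($\neg\wedge$right$^t$) $\alpha,\beta,\Gamma\Rightarrow\Delta$ / $\Gamma\Rightarrow\Delta,\neg(\alpha\wedge\beta)$. ($\neg\vee$left$^t$) $\Gamma\Rightarrow\Delta,\alpha,\beta$ / $\neg(\alpha\vee\beta),\Gamma\Rightarrow\Delta$. ($\neg\vee$right$^t$) $\alpha,\Gamma\Rightarrow\Delta$; $\beta,\Gamma\Rightarrow\Delta$ / $\Gamma\Rightarrow\Delta,\neg(\alpha\vee\beta)$. ($\neg\to$left$^t$) $\alpha,\Gamma\Rightarrow\Delta,\beta$ / $\neg(\alpha\to\beta),\Gamma\Rightarrow\Delta$. ($\neg\to$right$^t$) $\Gamma\Rightarrow\Delta,\alpha$; $\beta,\Gamma\Rightarrow\Delta$ / $\Gamma\Rightarrow\Delta,\neg(\alpha\to\beta)$. ($\neg\Box$left$^t$) $\Box\Gamma_1,\neg\Diamond\Gamma_2\Rightarrow\Diamond\Delta_1,\neg\Box\Delta_2,\alpha$ / $\neg\Box\alpha,\Box\Gamma_1,\neg\Diamond\Gamma_2\Rightarrow\Diamond\Delta_1,\neg\Box\Delta_2$.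 ($\neg\Box$right$^t$) $\alpha,\Gamma\Rightarrow\Delta$ / $\Gamma\Rightarrow\Delta,\neg\Box\alpha$. ($\neg\Diamond$left$^t$) $\Gamma\Rightarrow\Delta,\alpha$ / $\neg\Diamond\alpha,\Gamma\Rightarrow\Delta$. ($\neg\Diamond$right$^t$) $\alpha,\Box\Gamma_1,\neg\Diamond\Gamma_2\Rightarrow\Diamond\Delta_1,\neg\Box\Delta_2$ / $\Box\Gamma_1,\neg\Diamond\Gamma_2\Rightarrow\Diamond\Delta_1,\neg\Box\Delta_2,\neg\Diamond\alpha$. The calculus gTS4 is obtained from lTS4 by replacing ($\Box$right), ($\Diamond$left), ($\neg\Box$left$^t$), ($\neg\Diamond$right$^t$) with: ($\Box$right$^T$) $\Box\Gamma_1,\Box\Delta_2\Rightarrow\Diamond\Delta_1,\Diamond\Gamma_2,\alpha$ / $\Box\Gamma_1,\neg\Diamond\Gamma_2\Rightarrow\Diamond\Delta_1,\neg\Box\Delta_2,\Box\alpha$. ($\Diamond$left$^T$) $\alpha,\Box\Gamma_1,\Box\Delta_2\Rightarrow\Diamond\Delta_1,\Diamond\Gamma_2$ / $\Diamond\alpha,\Box\Gamma_1,\neg\Diamond\Gamma_2\Rightarrow\Diamond\Delta_1,\neg\Box\Delta_2$. ($\neg\Box$left$^T$) $\Box\Gamma_1,\Box\Delta_2\Rightarrow\Diamond\Delta_1,\Diamond\Gamma_2,\alpha$ / $\neg\Box\alpha,\Box\Gamma_1,\neg\Diamond\Gamma_2\Rightarrow\Diamond\Delta_1,\neg\Box\Delta_2$.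 ($\neg\Diamond$right$^T$) $\alpha,\Box\Gamma_1,\Box\Delta_2\Rightarrow\Diamond\Delta_1,\Diamond\Gamma_2$ / $\Box\Gamma_1,\neg\Diamond\Gamma_2\Rightarrow\Diamond\Delta_1,\neg\Box\Delta_2,\neg\Diamond\alpha$. (All other rules and initial sequents of lTS4, including ($\neg\Diamond$left$^t$), are kept.) -}

module Defs where

open import Data.Nat using (ℕ)
open import Data.Bool using (Bool; true; false)
open import Data.List using (List; []; _∷_; _++_; map)
open import Data.List.Membership.Propositional using (_∈_)
open import Data.Product using (_×_)
open import Relation.Binary.PropositionalEquality using (_≡_)

data Fm : Set where
  var  : ℕ → Fm
  _∧_  : Fm → Fm → Fm
  _∨_  : Fm → Fm → Fm
  _⇒_  : Fm → Fm → Fm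
  ¬_   : Fm → Fm
  □_   : Fm → Fm
  ◇_   : Fm → Fm

infixr 8 _∧_
infixr 7 _∨_
infixr 6 _⇒_
infix 9 ¬_ □_ ◇_

-- Finite sets of formulas are represented by lists; two lists denote the
-- same set iff they have the same members.
_≈ₛ_ : List Fm → List Fm → Set
Γ ≈ₛ Γ' = (∀ {φ} → φ ∈ Γ → φ ∈ Γ') × (∀ {φ} → φ ∈ Γ' → φ ∈ Γ)

data Calc : Set where
  lTS4 gTS4 : Calc

□* ◇* ¬◇* ¬□* : List Fm → List Fm
□* = map □_
◇* = map ◇_
¬◇* = map (λ a → ¬ (◇ a))
¬□* = map (λ a → ¬ (□ a))

-- The rule (set) makes sequents into pairs of finite *sets*: provability
-- depends only on the sets denoted by the lists.
data Prov (L : Calc) (c : Bool) : List Fm → List Fm → Set where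
  set   : ∀ {Γ Γ' Δ Δ'} → Γ ≈ₛ Γ' → Δ ≈ₛ Δ' → Prov L c Γ Δ → Prov L c Γ' Δ'
  ax₁   : ∀ p → Prov L c (var p ∷ []) (var p ∷ [])
  ax₂   : ∀ p → Prov L c (¬ var p ∷ []) (¬ var p ∷ [])
  ax₃   : ∀ p → Prov L c (¬ var p ∷ var p ∷ []) []
  ax₄   : ∀ p → Prov L c [] (¬ var p ∷ var p ∷ [])
  cut   : ∀ {Γ Δ α} → c ≡ true → Prov L c Γ (α ∷ []) → Prov L c (α ∷ Γ) Δ → Prov L c Γ Δ
  weL   : ∀ {Γ Δ α} → Prov L c Γ Δ → Prov L c (α ∷ Γ) Δ
  weR   : ∀ {Γ Δ α} → Prov L c Γ Δ → Prov L c Γ (α ∷ Δ)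
  ∧L    : ∀ {Γ Δ α β} → Prov L c (α ∷ β ∷ Γ) Δ → Prov L c (α ∧ β ∷ Γ) Δ
  ∧R    : ∀ {Γ Δ α β} → Prov L c Γ (α ∷ Δ) → Prov L c Γ (β ∷ Δ) → Prov L c Γ (α ∧ β ∷ Δ)
  ∨L    : ∀ {Γ Δ α β} → Prov L c (α ∷ Γ) Δ → Prov L c (β ∷ Γ) Δ → Prov L c (α ∨ β ∷ Γ) Δ
  ∨R    : ∀ {Γ Δ α β} → Prov L c Γ (α ∷ β ∷ Δ) → Prov L c Γ (α ∨ β ∷ Δ)
  ⇒L    : ∀ {Γ Δ α β} → Prov L c Γ (α ∷ Δ) → Prov L c (β ∷ Γ) Δ → Prov L c (α ⇒ β ∷ Γ) Δ
  ⇒R    : ∀ {Γ Δ α β} → Prov L c (α ∷ Γ) (β ∷ Δ) → Prov L c Γ (α ⇒ β ∷ Δ)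
  □L    : ∀ {Γ Δ α} → Prov L c (α ∷ Γ) Δ → Prov L c (□ α ∷ Γ) Δ
  ◇R    : ∀ {Γ Δ α} → Prov L c Γ (α ∷ Δ) → Prov L c Γ (◇ α ∷ Δ)
  ¬¬L   : ∀ {Γ Δ α} → Prov L c (α ∷ Γ) Δ → Prov L c (¬ ¬ α ∷ Γ) Δ
  ¬¬R   : ∀ {Γ Δ α} → Prov L c Γ (α ∷ Δ) → Prov L c Γ (¬ ¬ α ∷ Δ)
  ¬∧L   : ∀ {Γ Δ α β} → Prov L c Γ (α ∷ Δ) → Prov L c Γ (β ∷ Δ) → Prov L c (¬ (α ∧ β) ∷ Γ) Δ
  ¬∧R   : ∀ {Γ Δ α β} → Prov L c (α ∷ β ∷ Γ) Δ → Prov L c Γ (¬ (α ∧ β) ∷ Δ)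
  ¬∨L   : ∀ {Γ Δ α β} → Prov L c Γ (α ∷ β ∷ Δ) → Prov L c (¬ (α ∨ β) ∷ Γ) Δ
  ¬∨R   : ∀ {Γ Δ α β} → Prov L c (α ∷ Γ) Δ → Prov L c (β ∷ Γ) Δ → Prov L c Γ (¬ (α ∨ β) ∷ Δ)
  ¬⇒L   : ∀ {Γ Δ α β} → Prov L c (α ∷ Γ) (β ∷ Δ) → Prov L c (¬ (α ⇒ β) ∷ Γ) Δ
  ¬⇒R   : ∀ {Γ Δ α β} → Prov L c Γ (α ∷ Δ) → Prov L c (β ∷ Γ) Δ → Prov L c Γ (¬ (α ⇒ β) ∷ Δ)
  ¬□R   : ∀ {Γ Δ α} → Prov L c (α ∷ Γ) Δ → Prov L c Γ (¬ □ α ∷ Δ)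
  ¬◇L   : ∀ {Γ Δ α} → Prov L c Γ (α ∷ Δ) → Prov L c (¬ ◇ α ∷ Γ) Δ
  □Rˡ   : ∀ {Γ₁ Γ₂ Δ₁ Δ₂ α} → L ≡ lTS4 →
          Prov L c (□* Γ₁ ++ ¬◇* Γ₂) (α ∷ ◇* Δ₁ ++ ¬□* Δ₂) →
          Prov L c (□* Γ₁ ++ ¬◇* Γ₂) (□ α ∷ ◇* Δ₁ ++ ¬□* Δ₂)
  ◇Lˡ   : ∀ {Γ₁ Γ₂ Δ₁ Δ₂ α} → L ≡ lTS4 →
          Prov L c (α ∷ □* Γ₁ ++ ¬◇* Γ₂) (◇* Δ₁ ++ ¬□* Δ₂) →
          Prov L c (◇ α ∷ □* Γ₁ ++ ¬◇* Γ₂) (◇* Δ₁ ++ ¬□* Δ₂)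
  ¬□Lˡ  : ∀ {Γ₁ Γ₂ Δ₁ Δ₂ α} → L ≡ lTS4 →
          Prov L c (□* Γ₁ ++ ¬◇* Γ₂) (α ∷ ◇* Δ₁ ++ ¬□* Δ₂) →
          Prov L c (¬ □ α ∷ □* Γ₁ ++ ¬◇* Γ₂) (◇* Δ₁ ++ ¬□* Δ₂)
  ¬◇Rˡ  : ∀ {Γ₁ Γ₂ Δ₁ Δ₂ α} → L ≡ lTS4 →
          Prov L c (α ∷ □* Γ₁ ++ ¬◇* Γ₂) (◇* Δ₁ ++ ¬□* Δ₂) →
          Prov L c (□* Γ₁ ++ ¬◇* Γ₂) (¬ ◇ α ∷ ◇* Δ₁ ++ ¬□* Δ₂)
  □Rᵍ   : ∀ {Γ₁ Γ₂ Δ₁ Δ₂ α} → L ≡ gTS4 →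
          Prov L c (□* Γ₁ ++ □* Δ₂) (α ∷ ◇* Δ₁ ++ ◇* Γ₂) →
          Prov L c (□* Γ₁ ++ ¬◇* Γ₂) (□ α ∷ ◇* Δ₁ ++ ¬□* Δ₂)
  ◇Lᵍ   : ∀ {Γ₁ Γ₂ Δ₁ Δ₂ α} → L ≡ gTS4 →
          Prov L c (α ∷ □* Γ₁ ++ □* Δ₂) (◇* Δ₁ ++ ◇* Γ₂) →
          Prov L c (◇ α ∷ □* Γ₁ ++ ¬◇* Γ₂) (◇* Δ₁ ++ ¬□* Δ₂)
  ¬□Lᵍ  : ∀ {Γ₁ Γ₂ Δ₁ Δ₂ α} → L ≡ gTS4 →
          Prov L c (□* Γ₁ ++ □* Δ₂) (α ∷ ◇* Δ₁ ++ ◇* Γ₂) →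
          Prov L c (¬ □ α ∷ □* Γ₁ ++ ¬◇* Γ₂) (◇* Δ₁ ++ ¬□* Δ₂)
  ¬◇Rᵍ  : ∀ {Γ₁ Γ₂ Δ₁ Δ₂ α} → L ≡ gTS4 →
          Prov L c (α ∷ □* Γ₁ ++ □* Δ₂) (◇* Δ₁ ++ ◇* Γ₂) →
          Prov L c (□* Γ₁ ++ ¬◇* Γ₂) (¬ ◇ α ∷ ◇* Δ₁ ++ ¬□* Δ₂)

-- Cut is eliminated through an auxiliary G3-style calculus in which principal
-- formulas are located by membership and kept in the premises, so that weakening
-- and contraction are built in, and derivations carry a bound on their height.
-- One modal rule covers the four modal rules of either calculus: the context of
-- its premise is computed from the conclusion and is idempotent, so it passes
-- unchanged into a further modal premise.  Going back from a modal premise to the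
-- conclusion needs "twisted" weakening: □ z on the left may be replaced by ¬ □ z on
-- the right (and ◇ z on the right by ¬ ◇ z on the left), because □L and ¬□R have
-- the same premise.  Cut is admissible in the auxiliary calculus by Gentzen's
-- induction on the size of the cut formula and the sum of the heights of the two
-- premises.  The non-standard case is a left premise ending in a modal rule that
-- carries the cut formula ◇ z or ¬ □ z into its premise: the cut is then pushed
-- into that premise, where in gTS4 a cut on ¬ □ z becomes a cut on the smaller □ z
-- (and one on ¬ ◇ z a cut on ◇ z).

module Submission where

open import Defs
open import Data.Bool using (Bool; true; false)
open import Data.List using (List; []; _∷_; _++_; map; concatMap)
open import Data.List.Membership.Propositional using (_∈_; find; lose)
open import Data.List.Membership.Propositional.Properties
  using (∈-++⁺ˡ; ∈-++⁺ʳ; ∈-++⁻; ∈-map⁺; ∈-map⁻; ∈-concatMap⁺; ∈-concatMap⁻)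
open import Data.List.Relation.Binary.Subset.Propositional using (_⊆_)
open import Data.List.Relation.Binary.Subset.Propositional.Properties
  using (⊆-refl; ∷⁺ʳ; ∈-∷⁺ʳ; ++⁺ʳ)
open import Data.List.Relation.Unary.Any using (here; there)
open import Data.Nat using (ℕ; zero; suc; _+_; _⊔_; _≤_; _<_; s≤s)
open import Data.Nat.Properties
  using (≤-refl; ≤-trans; +-monoʳ-≤; +-suc; n≤1+n; n<1+n; m<n⇒m<1+n; m≤m+n; m≤n+m; m≤m⊔n; m≤n⊔m)
open import Data.Product using (∃; _×_; _,_; proj₁; proj₂)
open import Data.Empty using (⊥; ⊥-elim)
open import Data.Sum using (_⊎_; inj₁; inj₂; [_,_]′)
open import Function using (_∘_)
open import Relation.Binary.PropositionalEquality using (_≡_; refl; subst)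
open import Induction.WellFounded using (Acc; acc)
open import Data.Nat.Induction using (<-wellFounded)

variable
  L : Calc
  n n' m k j : ℕ
  Γ Δ Γ' Δ' Γ₁ Δ₁ Γ₂ Δ₂ : List Fm
  α φ ψ a b x : Fm

∈-concatMap⁺′ : ∀ (f : Fm → List Fm) → φ ∈ Γ → ψ ∈ f φ → ψ ∈ concatMap f Γ
∈-concatMap⁺′ f φ∈Γ ψ∈fφ = ∈-concatMap⁺ f (lose φ∈Γ ψ∈fφ)

∈-concatMap⁻′ : ∀ (f : Fm → List Fm) → ψ ∈ concatMap f Γ → ∃ λ φ → φ ∈ Γ × ψ ∈ f φ
∈-concatMap⁻′ f = find ∘ ∈-concatMap⁻ f

drop-[] : ∀ {X A : List Fm} → X ≡ [] → X ++ A ⊆ A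
drop-[] refl p = p

++-⊆ : ∀ A {B C : List Fm} → A ⊆ C → B ⊆ C → A ++ B ⊆ C
++-⊆ A A⊆C B⊆C = [ A⊆C , B⊆C ]′ ∘ ∈-++⁻ A

swap⊆ : Γ ⊆ α ∷ Δ → φ ∷ Γ ⊆ α ∷ φ ∷ Δ
swap⊆ Γ⊆ (here refl) = there (here refl)
swap⊆ Γ⊆ (there p) with Γ⊆ p
... | here q  = here q
... | there q = there (there q)

map-⊆ : ∀ {A B} X (f g : Fm → Fm) →
        (∀ {z} → f z ∈ A → g z ∈ B) → map f X ⊆ A → map g X ⊆ B
map-⊆ X f g f→g X⊆A p with ∈-map⁻ g p
... | z , z∈X , refl = f→g (X⊆A (∈-map⁺ f z∈X))

-- Formulas and the contexts of modal premises

data Shape : Fm → Set where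
  □ˢ     : ∀ z → Shape (□ z)
  ◇ˢ     : ∀ z → Shape (◇ z)
  ¬□ˢ    : ∀ z → Shape (¬ □ z)
  ¬◇ˢ    : ∀ z → Shape (¬ ◇ z)
  plainˢ : Shape φ

shape : (φ : Fm) → Shape φ
shape (□ z)     = □ˢ z
shape (◇ z)     = ◇ˢ z
shape (¬ (□ z)) = ¬□ˢ z
shape (¬ (◇ z)) = ¬◇ˢ z
shape _         = plainˢ

-- What a formula of the antecedent (ant…) or succedent (suc…) of a modal
-- conclusion contributes to the antecedent (…L) or succedent (…R) of its premise.
-- The first clauses of antR and sucL make them split on the shape first, so that
-- they compute for an unknown calculus except on ¬◇ˢ and ¬□ˢ respectively.
antL antR sucL sucR : Calc → Shape φ → List Fm
antL _    (□ˢ z)  = □ z ∷ []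
antL lTS4 (¬◇ˢ z) = ¬ ◇ z ∷ []
antL _    _       = []
antR _    (□ˢ _)  = []
antR gTS4 (¬◇ˢ z) = ◇ z ∷ []
antR _    _       = []
sucL _    (□ˢ _)  = []
sucL gTS4 (¬□ˢ z) = □ z ∷ []
sucL _    _       = []
sucR _    (◇ˢ z)  = ◇ z ∷ []
sucR lTS4 (¬□ˢ z) = ¬ □ z ∷ []
sucR _    _       = []

antL-self : ∀ L (s : Shape φ) → ψ ∈ antL L s → ψ ≡ φ
antL-self L    (□ˢ z)  (here refl) = refl
antL-self lTS4 (¬◇ˢ z) (here refl) = refl

sucR-self : ∀ L (s : Shape φ) → ψ ∈ sucR L s → ψ ≡ φ
sucR-self L    (◇ˢ z)  (here refl) = refl
sucR-self lTS4 (¬□ˢ z) (here refl) = refl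

sucL-untwist : ∀ L (s : Shape φ) → ψ ∈ sucL L s → ∃ λ z → φ ≡ ¬ □ z × ψ ≡ □ z
sucL-untwist gTS4 (¬□ˢ z) (here refl) = z , refl , refl

antR-untwist : ∀ L (s : Shape φ) → ψ ∈ antR L s → ∃ λ z → φ ≡ ¬ ◇ z × ψ ≡ ◇ z
antR-untwist gTS4 (¬◇ˢ z) (here refl) = z , refl , refl

sucL-lTS4 : (s : Shape φ) → ψ ∈ sucL lTS4 s → ⊥
sucL-lTS4 (¬□ˢ _) ()

antR-lTS4 : (s : Shape φ) → ψ ∈ antR lTS4 s → ⊥
antR-lTS4 (¬◇ˢ _) ()

-- Opaque, so that unification can read L, Γ and Δ off modalL L Γ Δ.
opaque
  modalL modalR : Calc → List Fm → List Fm → List Fm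
  modalL L Γ Δ = concatMap (λ φ → antL L (shape φ)) Γ
              ++ concatMap (λ φ → sucL L (shape φ)) Δ
  modalR L Γ Δ = concatMap (λ φ → antR L (shape φ)) Γ
              ++ concatMap (λ φ → sucR L (shape φ)) Δ

  ∈-modalL-ant : ∀ {L Γ Δ} → φ ∈ Γ → ψ ∈ antL L (shape φ) → ψ ∈ modalL L Γ Δ
  ∈-modalL-ant φ∈Γ = ∈-++⁺ˡ ∘ ∈-concatMap⁺′ _ φ∈Γ

  ∈-modalL-suc : ∀ {L Γ Δ} → φ ∈ Δ → ψ ∈ sucL L (shape φ) → ψ ∈ modalL L Γ Δ
  ∈-modalL-suc φ∈Δ = ∈-++⁺ʳ _ ∘ ∈-concatMap⁺′ _ φ∈Δ

  ∈-modalR-ant : ∀ {L Γ Δ} → φ ∈ Γ → ψ ∈ antR L (shape φ) → ψ ∈ modalR L Γ Δ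
  ∈-modalR-ant φ∈Γ = ∈-++⁺ˡ ∘ ∈-concatMap⁺′ _ φ∈Γ

  ∈-modalR-suc : ∀ {L Γ Δ} → φ ∈ Δ → ψ ∈ sucR L (shape φ) → ψ ∈ modalR L Γ Δ
  ∈-modalR-suc φ∈Δ = ∈-++⁺ʳ _ ∘ ∈-concatMap⁺′ _ φ∈Δ

  ∈-modalL⁻ : ∀ {L Γ Δ} → ψ ∈ modalL L Γ Δ →
              (∃ λ φ → φ ∈ Γ × ψ ∈ antL L (shape φ)) ⊎ (∃ λ φ → φ ∈ Δ × ψ ∈ sucL L (shape φ))
  ∈-modalL⁻ {Γ = Γ} p with ∈-++⁻ (concatMap _ Γ) p
  ... | inj₁ q = inj₁ (∈-concatMap⁻′ _ q)
  ... | inj₂ q = inj₂ (∈-concatMap⁻′ _ q)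

  ∈-modalR⁻ : ∀ {L Γ Δ} → ψ ∈ modalR L Γ Δ →
              (∃ λ φ → φ ∈ Γ × ψ ∈ antR L (shape φ)) ⊎ (∃ λ φ → φ ∈ Δ × ψ ∈ sucR L (shape φ))
  ∈-modalR⁻ {Γ = Γ} p with ∈-++⁻ (concatMap _ Γ) p
  ... | inj₁ q = inj₁ (∈-concatMap⁻′ _ q)
  ... | inj₂ q = inj₂ (∈-concatMap⁻′ _ q)

-- A height-indexed G3 calculus

data ModalRule : Set where
  □R ¬◇R ◇L ¬□L : ModalRule

bodyL bodyR : ModalRule → Fm → List Fm
bodyL ◇L  a = a ∷ []
bodyL ¬◇R a = a ∷ []
bodyL _   _ = []
bodyR □R  a = a ∷ []
bodyR ¬□L a = a ∷ []
bodyR _   _ = []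

Principal : ModalRule → Fm → List Fm → List Fm → Set
Principal □R  a Γ Δ = □ a ∈ Δ
Principal ¬◇R a Γ Δ = ¬ ◇ a ∈ Δ
Principal ◇L  a Γ Δ = ◇ a ∈ Γ
Principal ¬□L a Γ Δ = ¬ □ a ∈ Γ

-- G3 L n Γ Δ: Γ ⇒ Δ has a derivation of height at most n.
data G3 (L : Calc) : ℕ → List Fm → List Fm → Set where
  ax₁ : ∀ {p} → var p ∈ Γ → var p ∈ Δ → G3 L n Γ Δ
  ax₂ : ∀ {p} → ¬ var p ∈ Γ → ¬ var p ∈ Δ → G3 L n Γ Δ
  ax₃ : ∀ {p} → ¬ var p ∈ Γ → var p ∈ Γ → G3 L n Γ Δ
  ax₄ : ∀ {p} → ¬ var p ∈ Δ → var p ∈ Δ → G3 L n Γ Δ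
  ∧L  : ∀ {a b} → a ∧ b ∈ Γ → G3 L n (a ∷ b ∷ Γ) Δ → G3 L (suc n) Γ Δ
  ∧R  : ∀ {a b} → a ∧ b ∈ Δ → G3 L n Γ (a ∷ Δ) → G3 L n Γ (b ∷ Δ) → G3 L (suc n) Γ Δ
  ∨L  : ∀ {a b} → a ∨ b ∈ Γ → G3 L n (a ∷ Γ) Δ → G3 L n (b ∷ Γ) Δ → G3 L (suc n) Γ Δ
  ∨R  : ∀ {a b} → a ∨ b ∈ Δ → G3 L n Γ (a ∷ b ∷ Δ) → G3 L (suc n) Γ Δ
  ⇒L  : ∀ {a b} → a ⇒ b ∈ Γ → G3 L n Γ (a ∷ Δ) → G3 L n (b ∷ Γ) Δ → G3 L (suc n) Γ Δ
  ⇒R  : ∀ {a b} → a ⇒ b ∈ Δ → G3 L n (a ∷ Γ) (b ∷ Δ) → G3 L (suc n) Γ Δ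
  □L  : ∀ {a} → □ a ∈ Γ → G3 L n (a ∷ Γ) Δ → G3 L (suc n) Γ Δ
  ◇R  : ∀ {a} → ◇ a ∈ Δ → G3 L n Γ (a ∷ Δ) → G3 L (suc n) Γ Δ
  ¬¬L : ∀ {a} → ¬ ¬ a ∈ Γ → G3 L n (a ∷ Γ) Δ → G3 L (suc n) Γ Δ
  ¬¬R : ∀ {a} → ¬ ¬ a ∈ Δ → G3 L n Γ (a ∷ Δ) → G3 L (suc n) Γ Δ
  ¬∧L : ∀ {a b} → ¬ (a ∧ b) ∈ Γ → G3 L n Γ (a ∷ Δ) → G3 L n Γ (b ∷ Δ) → G3 L (suc n) Γ Δ
  ¬∧R : ∀ {a b} → ¬ (a ∧ b) ∈ Δ → G3 L n (a ∷ b ∷ Γ) Δ → G3 L (suc n) Γ Δ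
  ¬∨L : ∀ {a b} → ¬ (a ∨ b) ∈ Γ → G3 L n Γ (a ∷ b ∷ Δ) → G3 L (suc n) Γ Δ
  ¬∨R : ∀ {a b} → ¬ (a ∨ b) ∈ Δ → G3 L n (a ∷ Γ) Δ → G3 L n (b ∷ Γ) Δ → G3 L (suc n) Γ Δ
  ¬⇒L : ∀ {a b} → ¬ (a ⇒ b) ∈ Γ → G3 L n (a ∷ Γ) (b ∷ Δ) → G3 L (suc n) Γ Δ
  ¬⇒R : ∀ {a b} → ¬ (a ⇒ b) ∈ Δ → G3 L n Γ (a ∷ Δ) → G3 L n (b ∷ Γ) Δ → G3 L (suc n) Γ Δ
  ¬□R : ∀ {a} → ¬ □ a ∈ Δ → G3 L n (a ∷ Γ) Δ → G3 L (suc n) Γ Δ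
  ¬◇L : ∀ {a} → ¬ ◇ a ∈ Γ → G3 L n Γ (a ∷ Δ) → G3 L (suc n) Γ Δ
  modal : ∀ r a → Principal r a Γ Δ →
          G3 L n (bodyL r a ++ modalL L Γ Δ) (bodyR r a ++ modalR L Γ Δ) → G3 L (suc n) Γ Δ

-- Twisted weakening

TwistL TwistR : Fm → List Fm → Set
TwistL φ Δ = ∃ λ z → φ ≡ □ z × ¬ □ z ∈ Δ
TwistR φ Γ = ∃ λ z → φ ≡ ◇ z × ¬ ◇ z ∈ Γ

infix 4 _∣_≼_∣_
record _∣_≼_∣_ (Γ Δ Γ' Δ' : List Fm) : Set where
  field
    left  : φ ∈ Γ → φ ∈ Γ' ⊎ TwistL φ Δ'
    right : φ ∈ Δ → φ ∈ Δ' ⊎ TwistR φ Γ'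
open _∣_≼_∣_

≼-⊆ : Γ ⊆ Γ' → Δ ⊆ Δ' → Γ ∣ Δ ≼ Γ' ∣ Δ'
≼-⊆ Γ⊆Γ' Δ⊆Δ' = record { left = inj₁ ∘ Γ⊆Γ' ; right = inj₁ ∘ Δ⊆Δ' }

≼-widen : Γ ∣ Δ ≼ Γ' ∣ Δ' → ∀ {Γ'' Δ''} → Γ' ⊆ Γ'' → Δ' ⊆ Δ'' → Γ ∣ Δ ≼ Γ'' ∣ Δ''
≼-widen {Γ' = Γ'} {Δ' = Δ'} ε {Γ''} {Δ''} Γ'⊆ Δ'⊆ =
  record { left = widenL ∘ left ε ; right = widenR ∘ right ε }
  where
  widenL : φ ∈ Γ' ⊎ TwistL φ Δ' → φ ∈ Γ'' ⊎ TwistL φ Δ''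
  widenL (inj₁ φ∈)           = inj₁ (Γ'⊆ φ∈)
  widenL (inj₂ (z , eq , t)) = inj₂ (z , eq , Δ'⊆ t)
  widenR : φ ∈ Δ' ⊎ TwistR φ Γ' → φ ∈ Δ'' ⊎ TwistR φ Γ''
  widenR (inj₁ φ∈)           = inj₁ (Δ'⊆ φ∈)
  widenR (inj₂ (z , eq , t)) = inj₂ (z , eq , Γ'⊆ t)

≼-++ : ∀ X Y → Γ ∣ Δ ≼ Γ' ∣ Δ' → X ++ Γ ∣ Y ++ Δ ≼ X ++ Γ' ∣ Y ++ Δ'
≼-++ {Γ = Γ} {Δ = Δ} {Γ' = Γ'} {Δ' = Δ'} X Y ε = record { left = prefixL ; right = prefixR }
  where
  ε' = ≼-widen ε (∈-++⁺ʳ X) (∈-++⁺ʳ Y)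
  prefixL : φ ∈ X ++ Γ → φ ∈ X ++ Γ' ⊎ TwistL φ (Y ++ Δ')
  prefixL p with ∈-++⁻ X p
  ... | inj₁ q = inj₁ (∈-++⁺ˡ q)
  ... | inj₂ q = left ε' q
  prefixR : φ ∈ Y ++ Δ → φ ∈ Y ++ Δ' ⊎ TwistR φ (X ++ Γ')
  prefixR p with ∈-++⁻ Y p
  ... | inj₁ q = inj₁ (∈-++⁺ˡ q)
  ... | inj₂ q = right ε' q

≼-∷L : Γ ∣ Δ ≼ Γ' ∣ Δ' → φ ∷ Γ ∣ Δ ≼ φ ∷ Γ' ∣ Δ'
≼-∷L {φ = φ} = ≼-++ (φ ∷ []) []

≼-∷R : Γ ∣ Δ ≼ Γ' ∣ Δ' → Γ ∣ φ ∷ Δ ≼ Γ' ∣ φ ∷ Δ'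
≼-∷R {φ = φ} = ≼-++ [] (φ ∷ [])

twist□ : ∀ L {z Γ Δ} → ¬ □ z ∈ Δ → □ z ∈ modalL L Γ Δ ⊎ TwistL (□ z) (modalR L Γ Δ)
twist□ lTS4 nb = inj₂ (_ , refl , ∈-modalR-suc nb (here refl))
twist□ gTS4 nb = inj₁ (∈-modalL-suc nb (here refl))

twist◇ : ∀ L {z Γ Δ} → ¬ ◇ z ∈ Γ → ◇ z ∈ modalR L Γ Δ ⊎ TwistR (◇ z) (modalL L Γ Δ)
twist◇ lTS4 nd = inj₂ (_ , refl , ∈-modalL-ant nd (here refl))
twist◇ gTS4 nd = inj₁ (∈-modalR-ant nd (here refl))

≼-modal : ∀ L → Γ ∣ Δ ≼ Γ' ∣ Δ' → modalL L Γ Δ ∣ modalR L Γ Δ ≼ modalL L Γ' Δ' ∣ modalR L Γ' Δ'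
≼-modal {Γ = Γ} {Δ = Δ} {Γ' = Γ'} {Δ' = Δ'} L ε = record { left = modalLeft ; right = modalRight }
  where
  modalLeft : ψ ∈ modalL L Γ Δ → ψ ∈ modalL L Γ' Δ' ⊎ TwistL ψ (modalR L Γ' Δ')
  modalLeft p with ∈-modalL⁻ p
  ... | inj₁ (φ , φ∈Γ , ψ∈) with antL-self L (shape φ) ψ∈ | left ε φ∈Γ
  ...   | refl | inj₁ φ∈Γ'            = inj₁ (∈-modalL-ant φ∈Γ' ψ∈)
  ...   | refl | inj₂ (z , refl , nb) = twist□ L nb
  modalLeft p | inj₂ (φ , φ∈Δ , ψ∈) with sucL-untwist L (shape φ) ψ∈ | right ε φ∈Δ
  ...   | z , refl , refl | inj₁ φ∈Δ' = inj₁ (∈-modalL-suc φ∈Δ' ψ∈)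
  modalRight : ψ ∈ modalR L Γ Δ → ψ ∈ modalR L Γ' Δ' ⊎ TwistR ψ (modalL L Γ' Δ')
  modalRight p with ∈-modalR⁻ p
  ... | inj₁ (φ , φ∈Γ , ψ∈) with antR-untwist L (shape φ) ψ∈ | left ε φ∈Γ
  ...   | z , refl , refl | inj₁ φ∈Γ' = inj₁ (∈-modalR-ant φ∈Γ' ψ∈)
  modalRight p | inj₂ (φ , φ∈Δ , ψ∈) with sucR-self L (shape φ) ψ∈ | right ε φ∈Δ
  ...   | refl | inj₁ φ∈Δ'            = inj₁ (∈-modalR-suc φ∈Δ' ψ∈)
  ...   | refl | inj₂ (z , refl , nd) = twist◇ L nd

keepL : Γ ∣ Δ ≼ Γ' ∣ Δ' → φ ∈ Γ → (∀ {z} → φ ≡ □ z → ⊥) → φ ∈ Γ'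
keepL ε φ∈Γ φ≢□ with left ε φ∈Γ
... | inj₁ φ∈Γ'         = φ∈Γ'
... | inj₂ (_ , eq , _) = ⊥-elim (φ≢□ eq)

keepR : Γ ∣ Δ ≼ Γ' ∣ Δ' → φ ∈ Δ → (∀ {z} → φ ≡ ◇ z → ⊥) → φ ∈ Δ'
keepR ε φ∈Δ φ≢◇ with right ε φ∈Δ
... | inj₁ φ∈Δ'         = φ∈Δ'
... | inj₂ (_ , eq , _) = ⊥-elim (φ≢◇ eq)

principal-≼ : ∀ r {a} → Γ ∣ Δ ≼ Γ' ∣ Δ' → Principal r a Γ Δ → Principal r a Γ' Δ'
principal-≼ □R  ε p = keepR ε p λ ()
principal-≼ ¬◇R ε p = keepR ε p λ ()
principal-≼ ◇L  ε p = keepL ε p λ ()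
principal-≼ ¬□L ε p = keepL ε p λ ()

twisted-weakening : G3 L n Γ Δ → n ≤ n' → Γ ∣ Δ ≼ Γ' ∣ Δ' → G3 L n' Γ' Δ'
twisted-weakening (ax₁ g d)   _ ε = ax₁ (keepL ε g λ ()) (keepR ε d λ ())
twisted-weakening (ax₂ g d)   _ ε = ax₂ (keepL ε g λ ()) (keepR ε d λ ())
twisted-weakening (ax₃ g h)   _ ε = ax₃ (keepL ε g λ ()) (keepL ε h λ ())
twisted-weakening (ax₄ g h)   _ ε = ax₄ (keepR ε g λ ()) (keepR ε h λ ())
twisted-weakening (∧L m e)    (s≤s n≤) ε =
  ∧L (keepL ε m λ ()) (twisted-weakening e n≤ (≼-∷L (≼-∷L ε)))
twisted-weakening (∧R m e f)  (s≤s n≤) ε =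
  ∧R (keepR ε m λ ()) (twisted-weakening e n≤ (≼-∷R ε)) (twisted-weakening f n≤ (≼-∷R ε))
twisted-weakening (∨L m e f)  (s≤s n≤) ε =
  ∨L (keepL ε m λ ()) (twisted-weakening e n≤ (≼-∷L ε)) (twisted-weakening f n≤ (≼-∷L ε))
twisted-weakening (∨R m e)    (s≤s n≤) ε =
  ∨R (keepR ε m λ ()) (twisted-weakening e n≤ (≼-∷R (≼-∷R ε)))
twisted-weakening (⇒L m e f)  (s≤s n≤) ε =
  ⇒L (keepL ε m λ ()) (twisted-weakening e n≤ (≼-∷R ε)) (twisted-weakening f n≤ (≼-∷L ε))
twisted-weakening (⇒R m e)    (s≤s n≤) ε =
  ⇒R (keepR ε m λ ()) (twisted-weakening e n≤ (≼-∷L (≼-∷R ε)))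
twisted-weakening (□L m e)    (s≤s n≤) ε with left ε m
... | inj₁ m'               = □L m' (twisted-weakening e n≤ (≼-∷L ε))
... | inj₂ (_ , refl , ¬□∈) = ¬□R ¬□∈ (twisted-weakening e n≤ (≼-∷L ε))
twisted-weakening (◇R m e)    (s≤s n≤) ε with right ε m
... | inj₁ m'               = ◇R m' (twisted-weakening e n≤ (≼-∷R ε))
... | inj₂ (_ , refl , ¬◇∈) = ¬◇L ¬◇∈ (twisted-weakening e n≤ (≼-∷R ε))
twisted-weakening (¬¬L m e)   (s≤s n≤) ε =
  ¬¬L (keepL ε m λ ()) (twisted-weakening e n≤ (≼-∷L ε))
twisted-weakening (¬¬R m e)   (s≤s n≤) ε =
  ¬¬R (keepR ε m λ ()) (twisted-weakening e n≤ (≼-∷R ε))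
twisted-weakening (¬∧L m e f) (s≤s n≤) ε =
  ¬∧L (keepL ε m λ ()) (twisted-weakening e n≤ (≼-∷R ε)) (twisted-weakening f n≤ (≼-∷R ε))
twisted-weakening (¬∧R m e)   (s≤s n≤) ε =
  ¬∧R (keepR ε m λ ()) (twisted-weakening e n≤ (≼-∷L (≼-∷L ε)))
twisted-weakening (¬∨L m e)   (s≤s n≤) ε =
  ¬∨L (keepL ε m λ ()) (twisted-weakening e n≤ (≼-∷R (≼-∷R ε)))
twisted-weakening (¬∨R m e f) (s≤s n≤) ε =
  ¬∨R (keepR ε m λ ()) (twisted-weakening e n≤ (≼-∷L ε)) (twisted-weakening f n≤ (≼-∷L ε))
twisted-weakening (¬⇒L m e)   (s≤s n≤) ε =
  ¬⇒L (keepL ε m λ ()) (twisted-weakening e n≤ (≼-∷L (≼-∷R ε)))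
twisted-weakening (¬⇒R m e f) (s≤s n≤) ε =
  ¬⇒R (keepR ε m λ ()) (twisted-weakening e n≤ (≼-∷R ε)) (twisted-weakening f n≤ (≼-∷L ε))
twisted-weakening (¬□R m e)   (s≤s n≤) ε =
  ¬□R (keepR ε m λ ()) (twisted-weakening e n≤ (≼-∷L ε))
twisted-weakening (¬◇L m e)   (s≤s n≤) ε =
  ¬◇L (keepL ε m λ ()) (twisted-weakening e n≤ (≼-∷R ε))
twisted-weakening {L = L} (modal r a p e) (s≤s n≤) ε =
  modal r a (principal-≼ r ε p)
    (twisted-weakening e n≤ (≼-++ (bodyL r a) (bodyR r a) (≼-modal L ε)))

weakening : G3 L n Γ Δ → Γ ⊆ Γ' → Δ ⊆ Δ' → G3 L n Γ' Δ'
weakening d Γ⊆Γ' Δ⊆Δ' = twisted-weakening d ≤-refl (≼-⊆ Γ⊆Γ' Δ⊆Δ')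

raise : n ≤ n' → G3 L n Γ Δ → G3 L n' Γ Δ
raise n≤n' d = twisted-weakening d n≤n' (≼-⊆ ⊆-refl ⊆-refl)

modal-≼-context : ∀ L → modalL L Γ Δ ∣ modalR L Γ Δ ≼ Γ ∣ Δ
modal-≼-context {Γ = Γ} {Δ = Δ} L = record { left = back-left ; right = back-right }
  where
  back-left : ψ ∈ modalL L Γ Δ → ψ ∈ Γ ⊎ TwistL ψ Δ
  back-left p with ∈-modalL⁻ p
  ... | inj₁ (φ , φ∈Γ , ψ∈) with antL-self L (shape φ) ψ∈
  ...   | refl = inj₁ φ∈Γ
  back-left p | inj₂ (φ , φ∈Δ , ψ∈) with sucL-untwist L (shape φ) ψ∈
  ...   | z , refl , refl = inj₂ (z , refl , φ∈Δ)
  back-right : ψ ∈ modalR L Γ Δ → ψ ∈ Δ ⊎ TwistR ψ Γ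
  back-right p with ∈-modalR⁻ p
  ... | inj₁ (φ , φ∈Γ , ψ∈) with antR-untwist L (shape φ) ψ∈
  ...   | z , refl , refl = inj₂ (z , refl , φ∈Γ)
  back-right p | inj₂ (φ , φ∈Δ , ψ∈) with sucR-self L (shape φ) ψ∈
  ...   | refl = inj₁ φ∈Δ

unbox : ∀ X Y → G3 L n (X ++ modalL L Γ Δ) (Y ++ modalR L Γ Δ) → G3 L n (X ++ Γ) (Y ++ Δ)
unbox {L = L} X Y d = twisted-weakening d ≤-refl (≼-++ X Y (modal-≼-context L))

modalL-self : ∀ L → ψ ∈ modalL L Γ Δ → ψ ∈ antL L (shape ψ)
modalL-self L p with ∈-modalL⁻ p
... | inj₁ (φ , _ , ψ∈) with antL-self L (shape φ) ψ∈
...   | refl = ψ∈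
modalL-self L p | inj₂ (φ , _ , ψ∈) with sucL-untwist L (shape φ) ψ∈
...   | _ , refl , refl = here refl

modalR-self : ∀ L → ψ ∈ modalR L Γ Δ → ψ ∈ sucR L (shape ψ)
modalR-self L p with ∈-modalR⁻ p
... | inj₁ (φ , _ , ψ∈) with antR-untwist L (shape φ) ψ∈
...   | _ , refl , refl = here refl
modalR-self L p | inj₂ (φ , _ , ψ∈) with sucR-self L (shape φ) ψ∈
...   | refl = ψ∈

modalL-⊆ : ∀ L {X Y} → modalL L Γ Δ ⊆ X → modalL L Γ Δ ⊆ modalL L X Y
modalL-⊆ L ⊆X p = ∈-modalL-ant (⊆X p) (modalL-self L p)

modalR-⊆ : ∀ L {X Y} → modalR L Γ Δ ⊆ Y → modalR L Γ Δ ⊆ modalR L X Y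
modalR-⊆ L ⊆Y p = ∈-modalR-suc (⊆Y p) (modalR-self L p)

modalL-extraL : Γ' ⊆ α ∷ Γ → Δ' ⊆ Δ → modalL L Γ' Δ' ⊆ antL L (shape α) ++ modalL L Γ Δ
modalL-extraL Γ'⊆ Δ'⊆ p with ∈-modalL⁻ p
... | inj₂ (_ , φ∈Δ' , ψ∈) = ∈-++⁺ʳ _ (∈-modalL-suc (Δ'⊆ φ∈Δ') ψ∈)
... | inj₁ (_ , φ∈Γ' , ψ∈) with Γ'⊆ φ∈Γ'
...   | here refl = ∈-++⁺ˡ ψ∈
...   | there φ∈Γ = ∈-++⁺ʳ _ (∈-modalL-ant φ∈Γ ψ∈)

modalR-extraL : Γ' ⊆ α ∷ Γ → Δ' ⊆ Δ → modalR L Γ' Δ' ⊆ antR L (shape α) ++ modalR L Γ Δ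
modalR-extraL Γ'⊆ Δ'⊆ p with ∈-modalR⁻ p
... | inj₂ (_ , φ∈Δ' , ψ∈) = ∈-++⁺ʳ _ (∈-modalR-suc (Δ'⊆ φ∈Δ') ψ∈)
... | inj₁ (_ , φ∈Γ' , ψ∈) with Γ'⊆ φ∈Γ'
...   | here refl = ∈-++⁺ˡ ψ∈
...   | there φ∈Γ = ∈-++⁺ʳ _ (∈-modalR-ant φ∈Γ ψ∈)

modalL-extraR : Γ' ⊆ Γ → Δ' ⊆ α ∷ Δ → modalL L Γ' Δ' ⊆ sucL L (shape α) ++ modalL L Γ Δ
modalL-extraR Γ'⊆ Δ'⊆ p with ∈-modalL⁻ p
... | inj₁ (_ , φ∈Γ' , ψ∈) = ∈-++⁺ʳ _ (∈-modalL-ant (Γ'⊆ φ∈Γ') ψ∈)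
... | inj₂ (_ , φ∈Δ' , ψ∈) with Δ'⊆ φ∈Δ'
...   | here refl = ∈-++⁺ˡ ψ∈
...   | there φ∈Δ = ∈-++⁺ʳ _ (∈-modalL-suc φ∈Δ ψ∈)

modalR-extraR : Γ' ⊆ Γ → Δ' ⊆ α ∷ Δ → modalR L Γ' Δ' ⊆ sucR L (shape α) ++ modalR L Γ Δ
modalR-extraR Γ'⊆ Δ'⊆ p with ∈-modalR⁻ p
... | inj₁ (_ , φ∈Γ' , ψ∈) = ∈-++⁺ʳ _ (∈-modalR-ant (Γ'⊆ φ∈Γ') ψ∈)
... | inj₂ (_ , φ∈Δ' , ψ∈) with Δ'⊆ φ∈Δ'
...   | here refl = ∈-++⁺ˡ ψ∈
...   | there φ∈Δ = ∈-++⁺ʳ _ (∈-modalR-suc φ∈Δ ψ∈)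

-- Soundness for the cut-free calculi

module _ {c : Bool} where

  weakenL* : ∀ X → Prov L c Γ Δ → Prov L c (X ++ Γ) Δ
  weakenL* []      d = d
  weakenL* (_ ∷ X) d = weL (weakenL* X d)

  weakenR* : ∀ X → Prov L c Γ Δ → Prov L c Γ (X ++ Δ)
  weakenR* []      d = d
  weakenR* (_ ∷ X) d = weR (weakenR* X d)

  Prov-mono : Γ ⊆ Γ' → Δ ⊆ Δ' → Prov L c Γ Δ → Prov L c Γ' Δ'
  Prov-mono {Γ' = Γ'} {Δ' = Δ'} Γ⊆ Δ⊆ d = set (absorb Γ⊆) (absorb Δ⊆) (weakenR* Δ' (weakenL* Γ' d))
    where
    absorb : ∀ {A B} → A ⊆ B → (B ++ A) ≈ₛ B
    absorb A⊆B = ++-⊆ _ ⊆-refl A⊆B , ∈-++⁺ˡ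

  contractL : φ ∈ Γ → Prov L c (φ ∷ Γ) Δ → Prov L c Γ Δ
  contractL φ∈Γ = Prov-mono (∈-∷⁺ʳ φ∈Γ ⊆-refl) ⊆-refl

  contractR : φ ∈ Δ → Prov L c Γ (φ ∷ Δ) → Prov L c Γ Δ
  contractR φ∈Δ = Prov-mono ⊆-refl (∈-∷⁺ʳ φ∈Δ ⊆-refl)

data Prefix : Set where
  □ₚ ◇ₚ ¬□ₚ ¬◇ₚ : Prefix

_·_ : Prefix → Fm → Fm
□ₚ  · z = □ z
◇ₚ  · z = ◇ z
¬□ₚ · z = ¬ □ z
¬◇ₚ · z = ¬ ◇ z

body : Prefix → Shape φ → List Fm
body □ₚ  (□ˢ z)  = z ∷ []
body ◇ₚ  (◇ˢ z)  = z ∷ []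
body ¬□ₚ (¬□ˢ z) = z ∷ []
body ¬◇ₚ (¬◇ˢ z) = z ∷ []
body _   _       = []

bodies : Prefix → List Fm → List Fm
bodies π = concatMap (λ φ → body π (shape φ))

bodies⁺ : ∀ π {z} → π · z ∈ Γ → z ∈ bodies π Γ
bodies⁺ π p = ∈-concatMap⁺′ _ p (body-self π)
  where
  body-self : ∀ π {z} → z ∈ body π (shape (π · z))
  body-self □ₚ  = here refl
  body-self ◇ₚ  = here refl
  body-self ¬□ₚ = here refl
  body-self ¬◇ₚ = here refl

body-prefixed : ∀ π {z} (s : Shape φ) → z ∈ body π s → φ ≡ π · z
body-prefixed □ₚ  (□ˢ _)  (here refl) = refl
body-prefixed ◇ₚ  (◇ˢ _)  (here refl) = refl
body-prefixed ¬□ₚ (¬□ˢ _) (here refl) = refl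
body-prefixed ¬◇ₚ (¬◇ˢ _) (here refl) = refl

prefixed-bodies⊆ : ∀ π → map (π ·_) (bodies π Γ) ⊆ Γ
prefixed-bodies⊆ π p with ∈-map⁻ (π ·_) p
... | z , z∈ , refl with ∈-concatMap⁻′ _ z∈
...   | φ , φ∈Γ , z∈body with body-prefixed π (shape φ) z∈body
...     | refl = φ∈Γ

∈-prefixed-bodies : ∀ π {z} → π · z ∈ Γ → π · z ∈ map (π ·_) (bodies π Γ)
∈-prefixed-bodies π p = ∈-map⁺ (π ·_) (bodies⁺ π p)

-- The lists Γ₁, Γ₂ (Δ₁, Δ₂) of a modal rule, read off the antecedent (succedent).
antFrame sucFrame : List Fm → List Fm
antFrame Γ = □* (bodies □ₚ Γ) ++ ¬◇* (bodies ¬◇ₚ Γ)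
sucFrame Δ = ◇* (bodies ◇ₚ Δ) ++ ¬□* (bodies ¬□ₚ Δ)

antFrame⊆ : antFrame Γ ⊆ Γ
antFrame⊆ = ++-⊆ _ (prefixed-bodies⊆ □ₚ) (prefixed-bodies⊆ ¬◇ₚ)

sucFrame⊆ : sucFrame Δ ⊆ Δ
sucFrame⊆ = ++-⊆ _ (prefixed-bodies⊆ ◇ₚ) (prefixed-bodies⊆ ¬□ₚ)

modalL-lTS4⊆ : modalL lTS4 Γ Δ ⊆ antFrame Γ
modalL-lTS4⊆ {Γ = Γ} p with ∈-modalL⁻ p
... | inj₁ (φ , φ∈Γ , ψ∈) = go (shape φ) φ∈Γ ψ∈
  where
  go : (s : Shape φ) → φ ∈ Γ → ψ ∈ antL lTS4 s → ψ ∈ antFrame Γ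
  go (□ˢ _)  φ∈ (here refl) = ∈-++⁺ˡ (∈-prefixed-bodies □ₚ φ∈)
  go (¬◇ˢ _) φ∈ (here refl) = ∈-++⁺ʳ _ (∈-prefixed-bodies ¬◇ₚ φ∈)
... | inj₂ (φ , _ , ψ∈) = ⊥-elim (sucL-lTS4 (shape φ) ψ∈)

modalR-lTS4⊆ : modalR lTS4 Γ Δ ⊆ sucFrame Δ
modalR-lTS4⊆ {Δ = Δ} p with ∈-modalR⁻ p
... | inj₁ (φ , _ , ψ∈) = ⊥-elim (antR-lTS4 (shape φ) ψ∈)
... | inj₂ (φ , φ∈Δ , ψ∈) = go (shape φ) φ∈Δ ψ∈
  where
  go : (s : Shape φ) → φ ∈ Δ → ψ ∈ sucR lTS4 s → ψ ∈ sucFrame Δ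
  go (◇ˢ _)  φ∈ (here refl) = ∈-++⁺ˡ (∈-prefixed-bodies ◇ₚ φ∈)
  go (¬□ˢ _) φ∈ (here refl) = ∈-++⁺ʳ _ (∈-prefixed-bodies ¬□ₚ φ∈)

modalL-gTS4⊆ : modalL gTS4 Γ Δ ⊆ □* (bodies □ₚ Γ) ++ □* (bodies ¬□ₚ Δ)
modalL-gTS4⊆ {Γ = Γ} {Δ = Δ} p with ∈-modalL⁻ p
... | inj₁ (φ , φ∈Γ , ψ∈) = go (shape φ) φ∈Γ ψ∈
  where
  go : (s : Shape φ) → φ ∈ Γ → ψ ∈ antL gTS4 s → ψ ∈ □* (bodies □ₚ Γ) ++ □* (bodies ¬□ₚ Δ)
  go (□ˢ _) φ∈ (here refl) = ∈-++⁺ˡ (∈-prefixed-bodies □ₚ φ∈)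
... | inj₂ (φ , φ∈Δ , ψ∈) = go (shape φ) φ∈Δ ψ∈
  where
  go : (s : Shape φ) → φ ∈ Δ → ψ ∈ sucL gTS4 s → ψ ∈ □* (bodies □ₚ Γ) ++ □* (bodies ¬□ₚ Δ)
  go (¬□ˢ _) φ∈ (here refl) = ∈-++⁺ʳ (□* (bodies □ₚ Γ)) (∈-map⁺ □_ (bodies⁺ ¬□ₚ φ∈))

modalR-gTS4⊆ : modalR gTS4 Γ Δ ⊆ ◇* (bodies ◇ₚ Δ) ++ ◇* (bodies ¬◇ₚ Γ)
modalR-gTS4⊆ {Γ = Γ} {Δ = Δ} p with ∈-modalR⁻ p
... | inj₁ (φ , φ∈Γ , ψ∈) = go (shape φ) φ∈Γ ψ∈
  where
  go : (s : Shape φ) → φ ∈ Γ → ψ ∈ antR gTS4 s → ψ ∈ ◇* (bodies ◇ₚ Δ) ++ ◇* (bodies ¬◇ₚ Γ)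
  go (¬◇ˢ _) φ∈ (here refl) = ∈-++⁺ʳ (◇* (bodies ◇ₚ Δ)) (∈-map⁺ ◇_ (bodies⁺ ¬◇ₚ φ∈))
... | inj₂ (φ , φ∈Δ , ψ∈) = go (shape φ) φ∈Δ ψ∈
  where
  go : (s : Shape φ) → φ ∈ Δ → ψ ∈ sucR gTS4 s → ψ ∈ ◇* (bodies ◇ₚ Δ) ++ ◇* (bodies ¬◇ₚ Γ)
  go (◇ˢ _) φ∈ (here refl) = ∈-++⁺ˡ (∈-prefixed-bodies ◇ₚ φ∈)

module _ {Γ Δ : List Fm} where
  private
    □Γ ¬◇Γ ◇Δ ¬□Δ : List Fm
    □Γ  = bodies □ₚ Γ
    ¬◇Γ = bodies ¬◇ₚ Γ
    ◇Δ  = bodies ◇ₚ Δ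
    ¬□Δ = bodies ¬□ₚ Δ

    concludeR : φ ∈ Δ → Prov L false (antFrame Γ) (φ ∷ sucFrame Δ) → Prov L false Γ Δ
    concludeR φ∈Δ = Prov-mono antFrame⊆ (∈-∷⁺ʳ φ∈Δ sucFrame⊆)

    concludeL : φ ∈ Γ → Prov L false (φ ∷ antFrame Γ) (sucFrame Δ) → Prov L false Γ Δ
    concludeL φ∈Γ = Prov-mono (∈-∷⁺ʳ φ∈Γ antFrame⊆) sucFrame⊆

  sound-modal : ∀ L r {a} → Principal r a Γ Δ →
                Prov L false (bodyL r a ++ modalL L Γ Δ) (bodyR r a ++ modalR L Γ Δ) →
                Prov L false Γ Δ
  sound-modal lTS4 □R p d = concludeR p
    (□Rˡ {Γ₁ = □Γ} {¬◇Γ} {◇Δ} {¬□Δ} refl (Prov-mono modalL-lTS4⊆ (∷⁺ʳ _ modalR-lTS4⊆) d))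
  sound-modal lTS4 ¬◇R p d = concludeR p
    (¬◇Rˡ {Γ₁ = □Γ} {¬◇Γ} {◇Δ} {¬□Δ} refl (Prov-mono (∷⁺ʳ _ modalL-lTS4⊆) modalR-lTS4⊆ d))
  sound-modal lTS4 ◇L p d = concludeL p
    (◇Lˡ {Γ₁ = □Γ} {¬◇Γ} {◇Δ} {¬□Δ} refl (Prov-mono (∷⁺ʳ _ modalL-lTS4⊆) modalR-lTS4⊆ d))
  sound-modal lTS4 ¬□L p d = concludeL p
    (¬□Lˡ {Γ₁ = □Γ} {¬◇Γ} {◇Δ} {¬□Δ} refl (Prov-mono modalL-lTS4⊆ (∷⁺ʳ _ modalR-lTS4⊆) d))
  sound-modal gTS4 □R p d = concludeR p
    (□Rᵍ {Γ₁ = □Γ} {¬◇Γ} {◇Δ} {¬□Δ} refl (Prov-mono modalL-gTS4⊆ (∷⁺ʳ _ modalR-gTS4⊆) d))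
  sound-modal gTS4 ¬◇R p d = concludeR p
    (¬◇Rᵍ {Γ₁ = □Γ} {¬◇Γ} {◇Δ} {¬□Δ} refl (Prov-mono (∷⁺ʳ _ modalL-gTS4⊆) modalR-gTS4⊆ d))
  sound-modal gTS4 ◇L p d = concludeL p
    (◇Lᵍ {Γ₁ = □Γ} {¬◇Γ} {◇Δ} {¬□Δ} refl (Prov-mono (∷⁺ʳ _ modalL-gTS4⊆) modalR-gTS4⊆ d))
  sound-modal gTS4 ¬□L p d = concludeL p
    (¬□Lᵍ {Γ₁ = □Γ} {¬◇Γ} {◇Δ} {¬□Δ} refl (Prov-mono modalL-gTS4⊆ (∷⁺ʳ _ modalR-gTS4⊆) d))

sound : G3 L n Γ Δ → Prov L false Γ Δ
sound (ax₁ g d)       = Prov-mono (∈-∷⁺ʳ g λ ()) (∈-∷⁺ʳ d λ ()) (ax₁ _)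
sound (ax₂ g d)       = Prov-mono (∈-∷⁺ʳ g λ ()) (∈-∷⁺ʳ d λ ()) (ax₂ _)
sound (ax₃ g h)       = Prov-mono (∈-∷⁺ʳ g (∈-∷⁺ʳ h λ ())) (λ ()) (ax₃ _)
sound (ax₄ g h)       = Prov-mono (λ ()) (∈-∷⁺ʳ g (∈-∷⁺ʳ h λ ())) (ax₄ _)
sound (∧L m e)        = contractL m (∧L (sound e))
sound (∧R m e f)      = contractR m (∧R (sound e) (sound f))
sound (∨L m e f)      = contractL m (∨L (sound e) (sound f))
sound (∨R m e)        = contractR m (∨R (sound e))
sound (⇒L m e f)      = contractL m (⇒L (sound e) (sound f))
sound (⇒R m e)        = contractR m (⇒R (sound e))
sound (□L m e)        = contractL m (□L (sound e))
sound (◇R m e)        = contractR m (◇R (sound e))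
sound (¬¬L m e)       = contractL m (¬¬L (sound e))
sound (¬¬R m e)       = contractR m (¬¬R (sound e))
sound (¬∧L m e f)     = contractL m (¬∧L (sound e) (sound f))
sound (¬∧R m e)       = contractR m (¬∧R (sound e))
sound (¬∨L m e)       = contractL m (¬∨L (sound e))
sound (¬∨R m e f)     = contractR m (¬∨R (sound e) (sound f))
sound (¬⇒L m e)       = contractL m (¬⇒L (sound e))
sound (¬⇒R m e f)     = contractR m (¬⇒R (sound e) (sound f))
sound (¬□R m e)       = contractR m (¬□R (sound e))
sound (¬◇L m e)       = contractL m (¬◇L (sound e))
sound {L = L} (modal r a p e) = sound-modal L r p (sound e)

-- Admissibility of cut

size : Fm → ℕ
size (var _) = 1
size (a ∧ b) = suc (size a + size b)
size (a ∨ b) = suc (size a + size b)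
size (a ⇒ b) = suc (size a + size b)
size (¬ a)   = suc (size a)
size (□ a)   = suc (size a)
size (◇ a)   = suc (size a)

module _ (a b : Fm) where

  size-<ˡ : size a < suc (size a + size b)
  size-<ˡ = s≤s (m≤m+n (size a) (size b))

  size-<ʳ : size b < suc (size a + size b)
  size-<ʳ = s≤s (m≤n+m (size b) (size a))

  size-<¬ˡ : size a < suc (suc (size a + size b))
  size-<¬ˡ = m<n⇒m<1+n size-<ˡ

  size-<¬ʳ : size b < suc (suc (size a + size b))
  size-<¬ʳ = m<n⇒m<1+n size-<ʳ

size-<¬ : ∀ a → size a < suc (suc (size a))
size-<¬ a = m<n⇒m<1+n (n<1+n (size a))

Derivable : Calc → List Fm → List Fm → Set
Derivable L Γ Δ = ∃ λ n → G3 L n Γ Δ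

by₁ : (∀ {j} → G3 L j Γ' Δ' → G3 L (suc j) Γ Δ) → Derivable L Γ' Δ' → Derivable L Γ Δ
by₁ rule (n , d) = suc n , rule d

by₂ : (∀ {j} → G3 L j Γ₁ Δ₁ → G3 L j Γ₂ Δ₂ → G3 L (suc j) Γ Δ) →
      Derivable L Γ₁ Δ₁ → Derivable L Γ₂ Δ₂ → Derivable L Γ Δ
by₂ rule (n , d) (m , e) = suc (n ⊔ m) , rule (raise (m≤m⊔n n m) d) (raise (m≤n⊔m n m) e)

weakenᴰ : Derivable L Γ Δ → Γ ⊆ Γ' → Δ ⊆ Δ' → Derivable L Γ' Δ'
weakenᴰ (n , d) Γ⊆ Δ⊆ = n , weakening d Γ⊆ Δ⊆

-- Γ₁ ⇒ Δ₁ and Γ₂ ⇒ Δ₂ are the premises of a cut on α with conclusion Γ ⇒ Δ,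
-- up to weakening and contraction.
record CutFrame (α : Fm) (Γ₁ Δ₁ Γ₂ Δ₂ Γ Δ : List Fm) : Set where
  constructor frame
  field
    Γ₁⊆ : Γ₁ ⊆ Γ
    Δ₁⊆ : Δ₁ ⊆ α ∷ Δ
    Γ₂⊆ : Γ₂ ⊆ α ∷ Γ
    Δ₂⊆ : Δ₂ ⊆ Δ
open CutFrame

exact : CutFrame α Γ (α ∷ Δ) (α ∷ Γ) Δ Γ Δ
exact = frame ⊆-refl ⊆-refl ⊆-refl ⊆-refl

module _ (F : CutFrame α Γ₁ Δ₁ Γ₂ Δ₂ Γ Δ) where

  extendL₁ : CutFrame α (φ ∷ Γ₁) Δ₁ Γ₂ Δ₂ (φ ∷ Γ) Δ
  extendL₁ = frame (∷⁺ʳ _ (Γ₁⊆ F)) (Δ₁⊆ F) (∷⁺ʳ _ there ∘ Γ₂⊆ F) (Δ₂⊆ F)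

  extendR₁ : CutFrame α Γ₁ (φ ∷ Δ₁) Γ₂ Δ₂ Γ (φ ∷ Δ)
  extendR₁ = frame (Γ₁⊆ F) (swap⊆ (Δ₁⊆ F)) (Γ₂⊆ F) (there ∘ Δ₂⊆ F)

  extendL₂ : CutFrame α Γ₁ Δ₁ (φ ∷ Γ₂) Δ₂ (φ ∷ Γ) Δ
  extendL₂ = frame (there ∘ Γ₁⊆ F) (Δ₁⊆ F) (swap⊆ (Γ₂⊆ F)) (Δ₂⊆ F)

  extendR₂ : CutFrame α Γ₁ Δ₁ Γ₂ (φ ∷ Δ₂) Γ (φ ∷ Δ)
  extendR₂ = frame (Γ₁⊆ F) (∷⁺ʳ _ there ∘ Δ₁⊆ F) (Γ₂⊆ F) (∷⁺ʳ _ (Δ₂⊆ F))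

module _ (X Y : List Fm) {A B : List Fm} where

  prefixed-frameˡ : ∀ {A₁ B₁} → A₁ ⊆ A → B₁ ⊆ α ∷ B →
                    CutFrame α (X ++ A₁) (Y ++ B₁) (α ∷ A) B (X ++ A) (Y ++ B)
  prefixed-frameˡ A₁⊆ B₁⊆ =
    frame (++⁺ʳ X A₁⊆) (++-⊆ Y (there ∘ ∈-++⁺ˡ) (∷⁺ʳ _ (∈-++⁺ʳ Y) ∘ B₁⊆))
          (∷⁺ʳ _ (∈-++⁺ʳ X)) (∈-++⁺ʳ Y)

  prefixed-frameʳ : ∀ {A₂ B₂} → A₂ ⊆ α ∷ A → B₂ ⊆ B →
                    CutFrame α A (α ∷ B) (X ++ A₂) (Y ++ B₂) (X ++ A) (Y ++ B)
  prefixed-frameʳ A₂⊆ B₂⊆ =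
    frame (∈-++⁺ʳ X) (∷⁺ʳ _ (∈-++⁺ʳ Y))
          (++-⊆ X (there ∘ ∈-++⁺ˡ) (∷⁺ʳ _ (∈-++⁺ʳ X) ∘ A₂⊆)) (++⁺ʳ Y B₂⊆)

data Possibility : Fm → Set where
  ◇-poss  : Possibility (◇ x)
  ¬□-poss : Possibility (¬ □ x)

principal-via-frame : ∀ r {b} → Possibility α → CutFrame α Γ₁ Δ₁ Γ₂ Δ₂ Γ Δ →
                      Principal r b Γ₁ Δ₁ → Principal r b Γ Δ
principal-via-frame □R  poss F p = skip poss (Δ₁⊆ F p)
  where
  skip : Possibility α → □ b ∈ α ∷ Δ → □ b ∈ Δ
  skip ◇-poss  (there q) = q
  skip ¬□-poss (there q) = q
principal-via-frame ¬◇R poss F p = skip poss (Δ₁⊆ F p)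
  where
  skip : Possibility α → ¬ ◇ b ∈ α ∷ Δ → ¬ ◇ b ∈ Δ
  skip ◇-poss  (there q) = q
  skip ¬□-poss (there q) = q
principal-via-frame ◇L  _ F p = Γ₁⊆ F p
principal-via-frame ¬□L _ F p = Γ₁⊆ F p

-- Whether the cut formula, in the succedent of the left premise or in the antecedent
-- of the right one, passes into the premise of a modal rule.
data SuccedentRole (L : Calc) (α : Fm) : Shape α → Set where
  inert    : ∀ {s} → sucL L s ≡ [] → sucR L s ≡ [] → SuccedentRole L α s
  possible : ∀ {s} → Possibility α → SuccedentRole L α s

succedentRole : ∀ L α → SuccedentRole L α (shape α)
succedentRole L α with shape α
... | □ˢ _   = inert refl refl
... | ◇ˢ _   = possible ◇-poss
... | ¬□ˢ _  = possible ¬□-poss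
... | ¬◇ˢ _  = inert refl refl
... | plainˢ = inert refl refl

data AntecedentRole : Calc → (α : Fm) → Shape α → Set where
  inert     : ∀ {s} → antL L s ≡ [] → antR L s ≡ [] → AntecedentRole L α s
  necessity : ∀ {s} → AntecedentRole L (□ x) s
  ¬◇ˡ       : ∀ {s} → AntecedentRole lTS4 (¬ ◇ x) s
  ¬◇ᵍ       : ∀ {s} → AntecedentRole gTS4 (¬ ◇ x) s

antecedentRole : ∀ L α → AntecedentRole L α (shape α)
antecedentRole L    α with shape α
antecedentRole L    α | □ˢ _   = necessity
antecedentRole L    α | ◇ˢ _   = inert refl refl
antecedentRole L    α | ¬□ˢ _  = inert refl refl
antecedentRole lTS4 α | ¬◇ˢ _  = ¬◇ˡ
antecedentRole gTS4 α | ¬◇ˢ _  = ¬◇ᵍ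
antecedentRole L    α | plainˢ = inert refl refl

-- A derivation of Γ ⇒ Δ whose last rule introduces α on the right, or is a modal
-- rule that carries α (a ◇ or ¬ □ formula of Δ) into its premise.
data RightIntro (L : Calc) : ℕ → Fm → List Fm → List Fm → Set where
  ax-var   : ∀ {p} → ¬ var p ∈ Δ → RightIntro L n (var p) Γ Δ
  ax-¬var  : ∀ {p} → var p ∈ Δ → RightIntro L n (¬ var p) Γ Δ
  by-∧R    : G3 L n Γ (a ∷ Δ) → G3 L n Γ (b ∷ Δ) → RightIntro L (suc n) (a ∧ b) Γ Δ
  by-∨R    : G3 L n Γ (a ∷ b ∷ Δ) → RightIntro L (suc n) (a ∨ b) Γ Δ
  by-⇒R    : G3 L n (a ∷ Γ) (b ∷ Δ) → RightIntro L (suc n) (a ⇒ b) Γ Δ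
  by-◇R    : G3 L n Γ (a ∷ Δ) → RightIntro L (suc n) (◇ a) Γ Δ
  by-¬¬R   : G3 L n Γ (a ∷ Δ) → RightIntro L (suc n) (¬ ¬ a) Γ Δ
  by-¬∧R   : G3 L n (a ∷ b ∷ Γ) Δ → RightIntro L (suc n) (¬ (a ∧ b)) Γ Δ
  by-¬∨R   : G3 L n (a ∷ Γ) Δ → G3 L n (b ∷ Γ) Δ → RightIntro L (suc n) (¬ (a ∨ b)) Γ Δ
  by-¬⇒R   : G3 L n Γ (a ∷ Δ) → G3 L n (b ∷ Γ) Δ → RightIntro L (suc n) (¬ (a ⇒ b)) Γ Δ
  by-¬□R   : G3 L n (a ∷ Γ) Δ → RightIntro L (suc n) (¬ □ a) Γ Δ
  by-□R    : G3 L n (modalL L Γ Δ) (a ∷ modalR L Γ Δ) → RightIntro L (suc n) (□ a) Γ Δ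
  by-¬◇R   : G3 L n (a ∷ modalL L Γ Δ) (modalR L Γ Δ) → RightIntro L (suc n) (¬ ◇ a) Γ Δ
  by-modal : ∀ r b → Principal r b Γ Δ → Possibility α →
             G3 L n (bodyL r b ++ modalL L Γ Δ) (bodyR r b ++ modalR L Γ Δ) →
             RightIntro L (suc n) α Γ Δ

var-partner : ∀ {p} → RightIntro L n (var p) Γ₁ Δ₁ → Δ₁ ⊆ var p ∷ Δ → ¬ var p ∈ Δ
var-partner (ax-var p) Δ₁⊆ with Δ₁⊆ p
... | there q = q

¬var-partner : ∀ {p} → RightIntro L n (¬ var p) Γ₁ Δ₁ → Δ₁ ⊆ ¬ var p ∷ Δ → var p ∈ Δ
¬var-partner (ax-¬var p) Δ₁⊆ with Δ₁⊆ p
... | there q = q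

shrink : ∀ {fuel} → n + suc j ≤ fuel → n + j ≤ fuel
shrink {n = n} {j = j} = ≤-trans (+-monoʳ-≤ n (n≤1+n j))

shrink-suc : ∀ {fuel} → suc k + suc j ≤ fuel → suc k + j ≤ fuel
shrink-suc {k = k} = shrink {n = suc k}

shift : ∀ {fuel} → suc k + suc j ≤ fuel → suc k + j < fuel
shift {k = k} {j = j} {fuel} = subst (λ t → suc t ≤ fuel) (+-suc k j)

-- Lexicographic induction on the size of the cut formula and on fuel, a bound on
-- the sum of the heights of the premises: cutᴸ works on the left premise until its
-- last rule introduces the cut formula, then cutᴿ works on the right one.
mutual

  cut-G3 : Acc _<_ (size α) → Derivable L Γ₁ Δ₁ → Derivable L Γ₂ Δ₂ →
           CutFrame α Γ₁ Δ₁ Γ₂ Δ₂ Γ Δ → Derivable L Γ Δ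
  cut-G3 ac (n , d₁) (m , d₂) F = cutᴸ (suc (n + m)) ac ≤-refl d₁ d₂ F

  cut-smaller : ∀ {s} → Acc _<_ s → size a < s → Derivable L Γ₁ Δ₁ → Derivable L Γ₂ Δ₂ →
                CutFrame a Γ₁ Δ₁ Γ₂ Δ₂ Γ Δ → Derivable L Γ Δ
  cut-smaller (acc smaller) a< D₁ D₂ F = cut-G3 (smaller a<) D₁ D₂ F

  cutᴸ : ∀ fuel → Acc _<_ (size α) → n + m < fuel → G3 L n Γ₁ Δ₁ → G3 L m Γ₂ Δ₂ →
         CutFrame α Γ₁ Δ₁ Γ₂ Δ₂ Γ Δ → Derivable L Γ Δ
  cutᴸ zero ac () _ _ _
  cutᴸ (suc fuel) ac (s≤s le) (ax₁ g d) d₂ F with Δ₁⊆ F d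
  ... | here refl = _ , weakening d₂ (∈-∷⁺ʳ (Γ₁⊆ F g) ⊆-refl ∘ Γ₂⊆ F) (Δ₂⊆ F)
  ... | there d'  = zero , ax₁ (Γ₁⊆ F g) d'
  cutᴸ (suc fuel) ac (s≤s le) (ax₂ g d) d₂ F with Δ₁⊆ F d
  ... | here refl = _ , weakening d₂ (∈-∷⁺ʳ (Γ₁⊆ F g) ⊆-refl ∘ Γ₂⊆ F) (Δ₂⊆ F)
  ... | there d'  = zero , ax₂ (Γ₁⊆ F g) d'
  cutᴸ (suc fuel) ac (s≤s le) (ax₃ g h) d₂ F = zero , ax₃ (Γ₁⊆ F g) (Γ₁⊆ F h)
  cutᴸ (suc fuel) ac (s≤s le) (ax₄ g h) d₂ F with Δ₁⊆ F g | Δ₁⊆ F h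
  ... | there g'  | there h'  = zero , ax₄ g' h'
  ... | here refl | there _   = cutᴿ fuel ac le (ax-¬var h) d₂ F
  ... | there _   | here refl = cutᴿ fuel ac le (ax-var g) d₂ F
  cutᴸ (suc fuel) ac (s≤s le) (∧L p e) d₂ F =
    by₁ (∧L (Γ₁⊆ F p)) (cutᴸ fuel ac le e d₂ (extendL₁ (extendL₁ F)))
  cutᴸ (suc fuel) ac (s≤s le) (∨L p e f) d₂ F =
    by₂ (∨L (Γ₁⊆ F p)) (cutᴸ fuel ac le e d₂ (extendL₁ F)) (cutᴸ fuel ac le f d₂ (extendL₁ F))
  cutᴸ (suc fuel) ac (s≤s le) (⇒L p e f) d₂ F =
    by₂ (⇒L (Γ₁⊆ F p)) (cutᴸ fuel ac le e d₂ (extendR₁ F)) (cutᴸ fuel ac le f d₂ (extendL₁ F))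
  cutᴸ (suc fuel) ac (s≤s le) (□L p e) d₂ F =
    by₁ (□L (Γ₁⊆ F p)) (cutᴸ fuel ac le e d₂ (extendL₁ F))
  cutᴸ (suc fuel) ac (s≤s le) (¬¬L p e) d₂ F =
    by₁ (¬¬L (Γ₁⊆ F p)) (cutᴸ fuel ac le e d₂ (extendL₁ F))
  cutᴸ (suc fuel) ac (s≤s le) (¬∧L p e f) d₂ F =
    by₂ (¬∧L (Γ₁⊆ F p)) (cutᴸ fuel ac le e d₂ (extendR₁ F)) (cutᴸ fuel ac le f d₂ (extendR₁ F))
  cutᴸ (suc fuel) ac (s≤s le) (¬∨L p e) d₂ F =
    by₁ (¬∨L (Γ₁⊆ F p)) (cutᴸ fuel ac le e d₂ (extendR₁ (extendR₁ F)))
  cutᴸ (suc fuel) ac (s≤s le) (¬⇒L p e) d₂ F =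
    by₁ (¬⇒L (Γ₁⊆ F p)) (cutᴸ fuel ac le e d₂ (extendL₁ (extendR₁ F)))
  cutᴸ (suc fuel) ac (s≤s le) (¬◇L p e) d₂ F =
    by₁ (¬◇L (Γ₁⊆ F p)) (cutᴸ fuel ac le e d₂ (extendR₁ F))
  cutᴸ (suc fuel) ac (s≤s le) (∧R p e f) d₂ F with Δ₁⊆ F p
  ... | here refl = cutᴿ fuel ac le (by-∧R e f) d₂ F
  ... | there p'  =
      by₂ (∧R p') (cutᴸ fuel ac le e d₂ (extendR₁ F))
          (cutᴸ fuel ac le f d₂ (extendR₁ F))
  cutᴸ (suc fuel) ac (s≤s le) (∨R p e) d₂ F with Δ₁⊆ F p
  ... | here refl = cutᴿ fuel ac le (by-∨R e) d₂ F
  ... | there p'  = by₁ (∨R p') (cutᴸ fuel ac le e d₂ (extendR₁ (extendR₁ F)))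
  cutᴸ (suc fuel) ac (s≤s le) (⇒R p e) d₂ F with Δ₁⊆ F p
  ... | here refl = cutᴿ fuel ac le (by-⇒R e) d₂ F
  ... | there p'  = by₁ (⇒R p') (cutᴸ fuel ac le e d₂ (extendL₁ (extendR₁ F)))
  cutᴸ (suc fuel) ac (s≤s le) (◇R p e) d₂ F with Δ₁⊆ F p
  ... | here refl = cutᴿ fuel ac le (by-◇R e) d₂ F
  ... | there p'  = by₁ (◇R p') (cutᴸ fuel ac le e d₂ (extendR₁ F))
  cutᴸ (suc fuel) ac (s≤s le) (¬¬R p e) d₂ F with Δ₁⊆ F p
  ... | here refl = cutᴿ fuel ac le (by-¬¬R e) d₂ F
  ... | there p'  = by₁ (¬¬R p') (cutᴸ fuel ac le e d₂ (extendR₁ F))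
  cutᴸ (suc fuel) ac (s≤s le) (¬∧R p e) d₂ F with Δ₁⊆ F p
  ... | here refl = cutᴿ fuel ac le (by-¬∧R e) d₂ F
  ... | there p'  = by₁ (¬∧R p') (cutᴸ fuel ac le e d₂ (extendL₁ (extendL₁ F)))
  cutᴸ (suc fuel) ac (s≤s le) (¬∨R p e f) d₂ F with Δ₁⊆ F p
  ... | here refl = cutᴿ fuel ac le (by-¬∨R e f) d₂ F
  ... | there p'  =
      by₂ (¬∨R p') (cutᴸ fuel ac le e d₂ (extendL₁ F))
          (cutᴸ fuel ac le f d₂ (extendL₁ F))
  cutᴸ (suc fuel) ac (s≤s le) (¬⇒R p e f) d₂ F with Δ₁⊆ F p
  ... | here refl = cutᴿ fuel ac le (by-¬⇒R e f) d₂ F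
  ... | there p'  =
      by₂ (¬⇒R p') (cutᴸ fuel ac le e d₂ (extendR₁ F))
          (cutᴸ fuel ac le f d₂ (extendL₁ F))
  cutᴸ (suc fuel) ac (s≤s le) (¬□R p e) d₂ F with Δ₁⊆ F p
  ... | here refl = cutᴿ fuel ac le (by-¬□R e) d₂ F
  ... | there p'  = by₁ (¬□R p') (cutᴸ fuel ac le e d₂ (extendL₁ F))
  cutᴸ (suc fuel) ac (s≤s le) (modal □R b p e) d₂ F with Δ₁⊆ F p
  ... | here refl = cutᴿ fuel ac le (by-□R e) d₂ F
  ... | there p'  = cutᴸ-modal fuel ac le □R b p' p e d₂ F
  cutᴸ (suc fuel) ac (s≤s le) (modal ¬◇R b p e) d₂ F with Δ₁⊆ F p
  ... | here refl = cutᴿ fuel ac le (by-¬◇R e) d₂ F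
  ... | there p'  = cutᴸ-modal fuel ac le ¬◇R b p' p e d₂ F
  cutᴸ (suc fuel) ac (s≤s le) (modal ◇L b p e) d₂ F =
    cutᴸ-modal fuel ac le ◇L b (Γ₁⊆ F p) p e d₂ F
  cutᴸ (suc fuel) ac (s≤s le) (modal ¬□L b p e) d₂ F =
    cutᴸ-modal fuel ac le ¬□L b (Γ₁⊆ F p) p e d₂ F

  cutᴸ-modal : ∀ fuel → Acc _<_ (size α) → suc k + m ≤ fuel → ∀ r b →
               Principal r b Γ Δ → Principal r b Γ₁ Δ₁ →
               G3 L k (bodyL r b ++ modalL L Γ₁ Δ₁) (bodyR r b ++ modalR L Γ₁ Δ₁) → G3 L m Γ₂ Δ₂ →
               CutFrame α Γ₁ Δ₁ Γ₂ Δ₂ Γ Δ → Derivable L Γ Δ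
  cutᴸ-modal {α = α} {L = L} fuel ac le r b p p₁ e d₂ F with succedentRole L α
  ... | inert noL noR = _ , modal r b p (weakening e
          (++⁺ʳ (bodyL r b) (drop-[] noL ∘ modalL-extraR (Γ₁⊆ F) (Δ₁⊆ F)))
          (++⁺ʳ (bodyR r b) (drop-[] noR ∘ modalR-extraR (Γ₁⊆ F) (Δ₁⊆ F))))
  ... | possible poss = cutᴿ fuel ac le (by-modal r b p₁ poss e) d₂ F

  cutᴿ : ∀ fuel → Acc _<_ (size α) → n + m ≤ fuel → RightIntro L n α Γ₁ Δ₁ → G3 L m Γ₂ Δ₂ →
         CutFrame α Γ₁ Δ₁ Γ₂ Δ₂ Γ Δ → Derivable L Γ Δ
  cutᴿ fuel ac le v (ax₁ g d) F with Γ₂⊆ F g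
  ... | here refl = zero , ax₄ (var-partner v (Δ₁⊆ F)) (Δ₂⊆ F d)
  ... | there g'  = zero , ax₁ g' (Δ₂⊆ F d)
  cutᴿ fuel ac le v (ax₂ g d) F with Γ₂⊆ F g
  ... | here refl = zero , ax₄ (Δ₂⊆ F d) (¬var-partner v (Δ₁⊆ F))
  ... | there g'  = zero , ax₂ g' (Δ₂⊆ F d)
  cutᴿ fuel ac le v (ax₃ g h) F with Γ₂⊆ F g | Γ₂⊆ F h
  ... | there g'  | there h'  = zero , ax₃ g' h'
  ... | here refl | there h'  = zero , ax₁ h' (¬var-partner v (Δ₁⊆ F))
  ... | there g'  | here refl = zero , ax₂ g' (var-partner v (Δ₁⊆ F))
  cutᴿ fuel ac le v (ax₄ g h) F = zero , ax₄ (Δ₂⊆ F g) (Δ₂⊆ F h)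
  cutᴿ fuel ac le v (∧R p f g) F =
    by₂ (∧R (Δ₂⊆ F p)) (cutᴿ fuel ac (shrink le) v f (extendR₂ F))
        (cutᴿ fuel ac (shrink le) v g (extendR₂ F))
  cutᴿ fuel ac le v (∨R p f) F =
    by₁ (∨R (Δ₂⊆ F p)) (cutᴿ fuel ac (shrink le) v f (extendR₂ (extendR₂ F)))
  cutᴿ fuel ac le v (⇒R p f) F =
    by₁ (⇒R (Δ₂⊆ F p)) (cutᴿ fuel ac (shrink le) v f (extendL₂ (extendR₂ F)))
  cutᴿ fuel ac le v (◇R p f) F =
    by₁ (◇R (Δ₂⊆ F p)) (cutᴿ fuel ac (shrink le) v f (extendR₂ F))
  cutᴿ fuel ac le v (¬¬R p f) F =
    by₁ (¬¬R (Δ₂⊆ F p)) (cutᴿ fuel ac (shrink le) v f (extendR₂ F))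
  cutᴿ fuel ac le v (¬∧R p f) F =
    by₁ (¬∧R (Δ₂⊆ F p)) (cutᴿ fuel ac (shrink le) v f (extendL₂ (extendL₂ F)))
  cutᴿ fuel ac le v (¬∨R p f g) F =
    by₂ (¬∨R (Δ₂⊆ F p)) (cutᴿ fuel ac (shrink le) v f (extendL₂ F))
        (cutᴿ fuel ac (shrink le) v g (extendL₂ F))
  cutᴿ fuel ac le v (¬⇒R p f g) F =
    by₂ (¬⇒R (Δ₂⊆ F p)) (cutᴿ fuel ac (shrink le) v f (extendR₂ F))
        (cutᴿ fuel ac (shrink le) v g (extendL₂ F))
  cutᴿ fuel ac le v (¬□R p f) F =
    by₁ (¬□R (Δ₂⊆ F p)) (cutᴿ fuel ac (shrink le) v f (extendL₂ F))
  cutᴿ fuel ac le v (∧L p f) F with Γ₂⊆ F p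
  ... | here refl = reduce-∧ fuel ac le v p f F
  ... | there p'  = by₁ (∧L p') (cutᴿ fuel ac (shrink le) v f (extendL₂ (extendL₂ F)))
  cutᴿ fuel ac le v (∨L p f g) F with Γ₂⊆ F p
  ... | here refl = reduce-∨ fuel ac le v p f g F
  ... | there p'  =
      by₂ (∨L p') (cutᴿ fuel ac (shrink le) v f (extendL₂ F))
          (cutᴿ fuel ac (shrink le) v g (extendL₂ F))
  cutᴿ fuel ac le v (⇒L p f g) F with Γ₂⊆ F p
  ... | here refl = reduce-⇒ fuel ac le v p f g F
  ... | there p'  =
      by₂ (⇒L p') (cutᴿ fuel ac (shrink le) v f (extendR₂ F))
          (cutᴿ fuel ac (shrink le) v g (extendL₂ F))
  cutᴿ fuel ac le v (□L p f) F with Γ₂⊆ F p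
  ... | here refl = reduce-□ fuel ac le v f F
  ... | there p'  = by₁ (□L p') (cutᴿ fuel ac (shrink le) v f (extendL₂ F))
  cutᴿ fuel ac le v (¬¬L p f) F with Γ₂⊆ F p
  ... | here refl = reduce-¬¬ fuel ac le v p f F
  ... | there p'  = by₁ (¬¬L p') (cutᴿ fuel ac (shrink le) v f (extendL₂ F))
  cutᴿ fuel ac le v (¬∧L p f g) F with Γ₂⊆ F p
  ... | here refl = reduce-¬∧ fuel ac le v p f g F
  ... | there p'  =
      by₂ (¬∧L p') (cutᴿ fuel ac (shrink le) v f (extendR₂ F))
          (cutᴿ fuel ac (shrink le) v g (extendR₂ F))
  cutᴿ fuel ac le v (¬∨L p f) F with Γ₂⊆ F p
  ... | here refl = reduce-¬∨ fuel ac le v p f F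
  ... | there p'  = by₁ (¬∨L p') (cutᴿ fuel ac (shrink le) v f (extendR₂ (extendR₂ F)))
  cutᴿ fuel ac le v (¬⇒L p f) F with Γ₂⊆ F p
  ... | here refl = reduce-¬⇒ fuel ac le v p f F
  ... | there p'  = by₁ (¬⇒L p') (cutᴿ fuel ac (shrink le) v f (extendL₂ (extendR₂ F)))
  cutᴿ fuel ac le v (¬◇L p f) F with Γ₂⊆ F p
  ... | here refl = reduce-¬◇ fuel ac le v f F
  ... | there p'  = by₁ (¬◇L p') (cutᴿ fuel ac (shrink le) v f (extendR₂ F))
  cutᴿ fuel ac le v (modal □R b p f) F = cut-into-modal fuel ac le □R b (Δ₂⊆ F p) f v F
  cutᴿ fuel ac le v (modal ¬◇R b p f) F = cut-into-modal fuel ac le ¬◇R b (Δ₂⊆ F p) f v F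
  cutᴿ fuel ac le v (modal ◇L b p f) F with Γ₂⊆ F p
  ... | here refl = reduce-◇ fuel ac le v p f F
  ... | there p'  = cut-into-modal fuel ac le ◇L b p' f v F
  cutᴿ fuel ac le v (modal ¬□L b p f) F with Γ₂⊆ F p
  ... | here refl = reduce-¬□ fuel ac le v p f F
  ... | there p'  = cut-into-modal fuel ac le ¬□L b p' f v F

  reduce-∧ : ∀ fuel → Acc _<_ (size (a ∧ b)) → n + suc j ≤ fuel → RightIntro L n (a ∧ b) Γ₁ Δ₁ →
             a ∧ b ∈ Γ₂ → G3 L j (a ∷ b ∷ Γ₂) Δ₂ →
             CutFrame (a ∧ b) Γ₁ Δ₁ Γ₂ Δ₂ Γ Δ → Derivable L Γ Δ
  reduce-∧ {a = a} {b = b} fuel ac le (by-∧R e₁ e₂) p f F =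
    let Γ⇒a = cutᴸ fuel ac le e₁ (∧L p f) (extendR₁ F)
        Γ⇒b = cutᴸ fuel ac le e₂ (∧L p f) (extendR₁ F)
        abΓ⇒ = cutᴿ fuel ac (shrink-suc le) (by-∧R e₁ e₂) f (extendL₂ (extendL₂ F))
        bΓ⇒ = cut-smaller ac (size-<ˡ a b) Γ⇒a abΓ⇒ (frame there ⊆-refl ⊆-refl ⊆-refl)
    in cut-smaller ac (size-<ʳ a b) Γ⇒b bΓ⇒ exact

  reduce-∨ : ∀ fuel → Acc _<_ (size (a ∨ b)) → n + suc j ≤ fuel → RightIntro L n (a ∨ b) Γ₁ Δ₁ →
             a ∨ b ∈ Γ₂ → G3 L j (a ∷ Γ₂) Δ₂ → G3 L j (b ∷ Γ₂) Δ₂ →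
             CutFrame (a ∨ b) Γ₁ Δ₁ Γ₂ Δ₂ Γ Δ → Derivable L Γ Δ
  reduce-∨ {a = a} {b = b} fuel ac le (by-∨R e) p f g F =
    let Γ⇒ab = cutᴸ fuel ac le e (∨L p f g) (extendR₁ (extendR₁ F))
        aΓ⇒ = cutᴿ fuel ac (shrink-suc le) (by-∨R e) f (extendL₂ F)
        bΓ⇒ = cutᴿ fuel ac (shrink-suc le) (by-∨R e) g (extendL₂ F)
        Γ⇒b = cut-smaller ac (size-<ˡ a b) Γ⇒ab aΓ⇒ (frame ⊆-refl ⊆-refl ⊆-refl there)
    in cut-smaller ac (size-<ʳ a b) Γ⇒b bΓ⇒ exact

  reduce-⇒ : ∀ fuel → Acc _<_ (size (a ⇒ b)) → n + suc j ≤ fuel → RightIntro L n (a ⇒ b) Γ₁ Δ₁ →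
             a ⇒ b ∈ Γ₂ → G3 L j Γ₂ (a ∷ Δ₂) → G3 L j (b ∷ Γ₂) Δ₂ →
             CutFrame (a ⇒ b) Γ₁ Δ₁ Γ₂ Δ₂ Γ Δ → Derivable L Γ Δ
  reduce-⇒ {a = a} {b = b} fuel ac le (by-⇒R e) p f g F =
    let aΓ⇒b = cutᴸ fuel ac le e (⇒L p f g) (extendL₁ (extendR₁ F))
        Γ⇒a = cutᴿ fuel ac (shrink-suc le) (by-⇒R e) f (extendR₂ F)
        bΓ⇒ = cutᴿ fuel ac (shrink-suc le) (by-⇒R e) g (extendL₂ F)
        Γ⇒b = cut-smaller ac (size-<ˡ a b) Γ⇒a aΓ⇒b (frame ⊆-refl (∷⁺ʳ _ there) ⊆-refl ⊆-refl)
    in cut-smaller ac (size-<ʳ a b) Γ⇒b bΓ⇒ exact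

  reduce-□ : ∀ fuel → Acc _<_ (size (□ a)) → n + suc j ≤ fuel → RightIntro L n (□ a) Γ₁ Δ₁ →
             G3 L j (a ∷ Γ₂) Δ₂ → CutFrame (□ a) Γ₁ Δ₁ Γ₂ Δ₂ Γ Δ → Derivable L Γ Δ
  reduce-□ {a = a} fuel ac le (by-□R e) f F =
    let aΓ⇒ = cutᴿ fuel ac (shrink-suc le) (by-□R e) f (extendL₂ F)
        Γ⇒a = _ , unbox [] (a ∷ []) (weakening e (modalL-extraR (Γ₁⊆ F) (Δ₁⊆ F))
                                                  (∷⁺ʳ a (modalR-extraR (Γ₁⊆ F) (Δ₁⊆ F))))
    in cut-smaller ac (n<1+n (size a)) Γ⇒a aΓ⇒ exact

  reduce-¬¬ : ∀ fuel → Acc _<_ (size (¬ ¬ a)) → n + suc j ≤ fuel → RightIntro L n (¬ ¬ a) Γ₁ Δ₁ →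
              ¬ ¬ a ∈ Γ₂ → G3 L j (a ∷ Γ₂) Δ₂ → CutFrame (¬ ¬ a) Γ₁ Δ₁ Γ₂ Δ₂ Γ Δ → Derivable L Γ Δ
  reduce-¬¬ {a = a} fuel ac le (by-¬¬R e) p f F =
    let Γ⇒a = cutᴸ fuel ac le e (¬¬L p f) (extendR₁ F)
        aΓ⇒ = cutᴿ fuel ac (shrink-suc le) (by-¬¬R e) f (extendL₂ F)
    in cut-smaller ac (size-<¬ a) Γ⇒a aΓ⇒ exact

  reduce-¬∧ : ∀ fuel → Acc _<_ (size (¬ (a ∧ b))) → n + suc j ≤ fuel →
              RightIntro L n (¬ (a ∧ b)) Γ₁ Δ₁ →
              ¬ (a ∧ b) ∈ Γ₂ → G3 L j Γ₂ (a ∷ Δ₂) → G3 L j Γ₂ (b ∷ Δ₂) →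
              CutFrame (¬ (a ∧ b)) Γ₁ Δ₁ Γ₂ Δ₂ Γ Δ → Derivable L Γ Δ
  reduce-¬∧ {a = a} {b = b} fuel ac le (by-¬∧R e) p f g F =
    let abΓ⇒ = cutᴸ fuel ac le e (¬∧L p f g) (extendL₁ (extendL₁ F))
        Γ⇒a = cutᴿ fuel ac (shrink-suc le) (by-¬∧R e) f (extendR₂ F)
        Γ⇒b = cutᴿ fuel ac (shrink-suc le) (by-¬∧R e) g (extendR₂ F)
        bΓ⇒ = cut-smaller ac (size-<¬ˡ a b) Γ⇒a abΓ⇒ (frame there ⊆-refl ⊆-refl ⊆-refl)
    in cut-smaller ac (size-<¬ʳ a b) Γ⇒b bΓ⇒ exact

  reduce-¬∨ : ∀ fuel → Acc _<_ (size (¬ (a ∨ b))) → n + suc j ≤ fuel →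
              RightIntro L n (¬ (a ∨ b)) Γ₁ Δ₁ →
              ¬ (a ∨ b) ∈ Γ₂ → G3 L j Γ₂ (a ∷ b ∷ Δ₂) →
              CutFrame (¬ (a ∨ b)) Γ₁ Δ₁ Γ₂ Δ₂ Γ Δ → Derivable L Γ Δ
  reduce-¬∨ {a = a} {b = b} fuel ac le (by-¬∨R e₁ e₂) p f F =
    let aΓ⇒ = cutᴸ fuel ac le e₁ (¬∨L p f) (extendL₁ F)
        bΓ⇒ = cutᴸ fuel ac le e₂ (¬∨L p f) (extendL₁ F)
        Γ⇒ab = cutᴿ fuel ac (shrink-suc le) (by-¬∨R e₁ e₂) f (extendR₂ (extendR₂ F))
        Γ⇒b = cut-smaller ac (size-<¬ˡ a b) Γ⇒ab aΓ⇒ (frame ⊆-refl ⊆-refl ⊆-refl there)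
    in cut-smaller ac (size-<¬ʳ a b) Γ⇒b bΓ⇒ exact

  reduce-¬⇒ : ∀ fuel → Acc _<_ (size (¬ (a ⇒ b))) → n + suc j ≤ fuel →
              RightIntro L n (¬ (a ⇒ b)) Γ₁ Δ₁ →
              ¬ (a ⇒ b) ∈ Γ₂ → G3 L j (a ∷ Γ₂) (b ∷ Δ₂) →
              CutFrame (¬ (a ⇒ b)) Γ₁ Δ₁ Γ₂ Δ₂ Γ Δ → Derivable L Γ Δ
  reduce-¬⇒ {a = a} {b = b} fuel ac le (by-¬⇒R e₁ e₂) p f F =
    let Γ⇒a = cutᴸ fuel ac le e₁ (¬⇒L p f) (extendR₁ F)
        bΓ⇒ = cutᴸ fuel ac le e₂ (¬⇒L p f) (extendL₁ F)
        aΓ⇒b = cutᴿ fuel ac (shrink-suc le) (by-¬⇒R e₁ e₂) f (extendL₂ (extendR₂ F))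
        Γ⇒b = cut-smaller ac (size-<¬ˡ a b) Γ⇒a aΓ⇒b (frame ⊆-refl (∷⁺ʳ _ there) ⊆-refl ⊆-refl)
    in cut-smaller ac (size-<¬ʳ a b) Γ⇒b bΓ⇒ exact

  reduce-¬◇ : ∀ fuel → Acc _<_ (size (¬ ◇ a)) → n + suc j ≤ fuel →
              RightIntro L n (¬ ◇ a) Γ₁ Δ₁ →
              G3 L j Γ₂ (a ∷ Δ₂) → CutFrame (¬ ◇ a) Γ₁ Δ₁ Γ₂ Δ₂ Γ Δ → Derivable L Γ Δ
  reduce-¬◇ {a = a} fuel ac le (by-¬◇R e) f F =
    let Γ⇒a = cutᴿ fuel ac (shrink-suc le) (by-¬◇R e) f (extendR₂ F)
        aΓ⇒ = _ , unbox (a ∷ []) [] (weakening e (∷⁺ʳ a (modalL-extraR (Γ₁⊆ F) (Δ₁⊆ F)))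
                                                  (modalR-extraR (Γ₁⊆ F) (Δ₁⊆ F)))
    in cut-smaller ac (size-<¬ a) Γ⇒a aΓ⇒ exact

  reduce-◇ : ∀ fuel → Acc _<_ (size (◇ b)) → n + suc j ≤ fuel → RightIntro L n (◇ b) Γ₁ Δ₁ →
             ◇ b ∈ Γ₂ → G3 L j (b ∷ modalL L Γ₂ Δ₂) (modalR L Γ₂ Δ₂) →
             CutFrame (◇ b) Γ₁ Δ₁ Γ₂ Δ₂ Γ Δ → Derivable L Γ Δ
  reduce-◇ {b = b} fuel ac le (by-◇R e) p f F =
    let Γ⇒b = cutᴸ fuel ac le e (modal ◇L b p f) (extendR₁ F)
        bΓ⇒ = _ , unbox (b ∷ []) [] (weakening f (∷⁺ʳ b (modalL-extraL (Γ₂⊆ F) (Δ₂⊆ F)))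
                                                  (modalR-extraL (Γ₂⊆ F) (Δ₂⊆ F)))
    in cut-smaller ac (n<1+n (size b)) Γ⇒b bΓ⇒ exact
  reduce-◇ {b = b} {L = L} fuel ac le (by-modal r c p₁ ◇-poss e) p f F =
    let ◇b-premise = modal ◇L b (here refl)
          (weakening f (∷⁺ʳ b (modalL-⊆ L there ∘ modalL-extraL (Γ₂⊆ F) (Δ₂⊆ F)))
                       (modalR-⊆ L ⊆-refl ∘ modalR-extraL (Γ₂⊆ F) (Δ₂⊆ F)))
    in by₁ (modal r c (principal-via-frame r ◇-poss F p₁))
           (cutᴸ fuel ac le e ◇b-premise
                 (prefixed-frameˡ (bodyL r c) (bodyR r c) (modalL-extraR (Γ₁⊆ F) (Δ₁⊆ F))
                                                          (modalR-extraR (Γ₁⊆ F) (Δ₁⊆ F))))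

  reduce-¬□ : ∀ fuel → Acc _<_ (size (¬ □ b)) → n + suc j ≤ fuel →
              RightIntro L n (¬ □ b) Γ₁ Δ₁ →
              ¬ □ b ∈ Γ₂ → G3 L j (modalL L Γ₂ Δ₂) (b ∷ modalR L Γ₂ Δ₂) →
              CutFrame (¬ □ b) Γ₁ Δ₁ Γ₂ Δ₂ Γ Δ → Derivable L Γ Δ
  reduce-¬□ {b = b} fuel ac le (by-¬□R e) p f F =
    let bΓ⇒ = cutᴸ fuel ac le e (modal ¬□L b p f) (extendL₁ F)
        Γ⇒b = _ , unbox [] (b ∷ []) (weakening f (modalL-extraL (Γ₂⊆ F) (Δ₂⊆ F))
                                                  (∷⁺ʳ b (modalR-extraL (Γ₂⊆ F) (Δ₂⊆ F))))
    in cut-smaller ac (size-<¬ b) Γ⇒b bΓ⇒ exact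
  reduce-¬□ fuel ac le (by-modal r c p₁ ¬□-poss e) p f F =
    cut-¬□-into-modal fuel ac le r c p₁ e f F

  cut-¬□-into-modal : ∀ fuel → Acc _<_ (size (¬ □ x)) → suc k + suc j ≤ fuel →
                      ∀ r c → Principal r c Γ₁ Δ₁ →
                      G3 L k (bodyL r c ++ modalL L Γ₁ Δ₁) (bodyR r c ++ modalR L Γ₁ Δ₁) →
                      G3 L j (modalL L Γ₂ Δ₂) (x ∷ modalR L Γ₂ Δ₂) →
                      CutFrame (¬ □ x) Γ₁ Δ₁ Γ₂ Δ₂ Γ Δ → Derivable L Γ Δ
  cut-¬□-into-modal {x = x} {L = lTS4} fuel ac le r c p₁ e f F =
    let ¬□x-premise = modal ¬□L x (here refl)
          (weakening f (modalL-⊆ lTS4 there ∘ modalL-extraL (Γ₂⊆ F) (Δ₂⊆ F))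
                       (∷⁺ʳ x (modalR-⊆ lTS4 ⊆-refl ∘ modalR-extraL (Γ₂⊆ F) (Δ₂⊆ F))))
    in by₁ (modal r c (principal-via-frame r ¬□-poss F p₁))
           (cutᴸ fuel ac le e ¬□x-premise
                 (prefixed-frameˡ (bodyL r c) (bodyR r c) (modalL-extraR (Γ₁⊆ F) (Δ₁⊆ F))
                                                          (modalR-extraR (Γ₁⊆ F) (Δ₁⊆ F))))
  -- In gTS4 the ¬ □ x of the left premise reaches its modal premise as □ x on the left.
  cut-¬□-into-modal {x = x} {L = gTS4} fuel ac le r c p₁ e f F =
    let □x-premise = modal □R x (here refl)
          (weakening f (modalL-⊆ gTS4 ⊆-refl ∘ modalL-extraL (Γ₂⊆ F) (Δ₂⊆ F))
                       (∷⁺ʳ x (modalR-⊆ gTS4 there ∘ modalR-extraL (Γ₂⊆ F) (Δ₂⊆ F))))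
    in by₁ (modal r c (principal-via-frame r ¬□-poss F p₁))
           (cut-smaller ac (n<1+n (size (□ x))) (_ , □x-premise) (_ , e)
                 (prefixed-frameʳ (bodyL r c) (bodyR r c) (modalL-extraR (Γ₁⊆ F) (Δ₁⊆ F))
                                                          (modalR-extraR (Γ₁⊆ F) (Δ₁⊆ F))))

  -- The right premise ends in a modal rule that is not principal for α.  If α
  -- passes into its premise, the left premise is rebuilt in the modal context
  -- (which is idempotent) and the cut moves up.
  cut-into-modal : ∀ fuel → Acc _<_ (size α) → n + suc j ≤ fuel → ∀ r b → Principal r b Γ Δ →
                   G3 L j (bodyL r b ++ modalL L Γ₂ Δ₂) (bodyR r b ++ modalR L Γ₂ Δ₂) →
                   RightIntro L n α Γ₁ Δ₁ → CutFrame α Γ₁ Δ₁ Γ₂ Δ₂ Γ Δ → Derivable L Γ Δ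
  cut-into-modal {α = α} {L = L} fuel ac le r b p f v F with antecedentRole L α
  ... | inert noL noR = _ , modal r b p (weakening f
          (++⁺ʳ (bodyL r b) (drop-[] noL ∘ modalL-extraL (Γ₂⊆ F) (Δ₂⊆ F)))
          (++⁺ʳ (bodyR r b) (drop-[] noR ∘ modalR-extraL (Γ₂⊆ F) (Δ₂⊆ F))))
  cut-into-modal {L = L} fuel ac le r b p f (by-□R {a = x} e) F | necessity =
    let □x-premise = modal □R x (here refl)
          (weakening e (modalL-⊆ L ⊆-refl ∘ modalL-extraR (Γ₁⊆ F) (Δ₁⊆ F))
                       (∷⁺ʳ x (modalR-⊆ L there ∘ modalR-extraR (Γ₁⊆ F) (Δ₁⊆ F))))
    in by₁ (modal r b p)
           (cutᴸ fuel ac (shift le) □x-premise f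
                 (prefixed-frameʳ (bodyL r b) (bodyR r b) (modalL-extraL (Γ₂⊆ F) (Δ₂⊆ F))
                                                          (modalR-extraL (Γ₂⊆ F) (Δ₂⊆ F))))
  cut-into-modal fuel ac le r b p f (by-¬◇R {a = x} e) F | ¬◇ˡ =
    let ¬◇x-premise = modal ¬◇R x (here refl)
          (weakening e (∷⁺ʳ x (modalL-⊆ lTS4 ⊆-refl ∘ modalL-extraR (Γ₁⊆ F) (Δ₁⊆ F)))
                       (modalR-⊆ lTS4 there ∘ modalR-extraR (Γ₁⊆ F) (Δ₁⊆ F)))
    in by₁ (modal r b p)
           (cutᴸ fuel ac (shift le) ¬◇x-premise f
                 (prefixed-frameʳ (bodyL r b) (bodyR r b) (modalL-extraL (Γ₂⊆ F) (Δ₂⊆ F))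
                                                          (modalR-extraL (Γ₂⊆ F) (Δ₂⊆ F))))
  cut-into-modal fuel ac le r b p f (by-¬◇R {a = x} e) F | ¬◇ᵍ =
    let ◇x-premise = modal ◇L x (here refl)
          (weakening e (∷⁺ʳ x (modalL-⊆ gTS4 there ∘ modalL-extraR (Γ₁⊆ F) (Δ₁⊆ F)))
                       (modalR-⊆ gTS4 ⊆-refl ∘ modalR-extraR (Γ₁⊆ F) (Δ₁⊆ F)))
    in by₁ (modal r b p)
           (cut-smaller ac (n<1+n (size (◇ x))) (_ , f) (_ , ◇x-premise)
                 (prefixed-frameˡ (bodyL r b) (bodyR r b) (modalL-extraL (Γ₂⊆ F) (Δ₂⊆ F))
                                                          (modalR-extraL (Γ₂⊆ F) (Δ₂⊆ F))))

-- Embedding derivations with cut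

module _ (Γ₁ Γ₂ Δ₁ Δ₂ : List Fm) {A B : List Fm} where

  lTS4-antecedent⊆ : □* Γ₁ ++ ¬◇* Γ₂ ⊆ A → □* Γ₁ ++ ¬◇* Γ₂ ⊆ modalL lTS4 A B
  lTS4-antecedent⊆ ⊆A = ++-⊆ (□* Γ₁)
    (map-⊆ Γ₁ _ _ (λ q → ∈-modalL-ant q (here refl)) (⊆A ∘ ∈-++⁺ˡ))
    (map-⊆ Γ₂ _ _ (λ q → ∈-modalL-ant q (here refl)) (⊆A ∘ ∈-++⁺ʳ (□* Γ₁)))

  lTS4-succedent⊆ : ◇* Δ₁ ++ ¬□* Δ₂ ⊆ B → ◇* Δ₁ ++ ¬□* Δ₂ ⊆ modalR lTS4 A B
  lTS4-succedent⊆ ⊆B = ++-⊆ (◇* Δ₁)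
    (map-⊆ Δ₁ _ _ (λ q → ∈-modalR-suc q (here refl)) (⊆B ∘ ∈-++⁺ˡ))
    (map-⊆ Δ₂ _ _ (λ q → ∈-modalR-suc q (here refl)) (⊆B ∘ ∈-++⁺ʳ (◇* Δ₁)))

  gTS4-antecedent⊆ : □* Γ₁ ++ ¬◇* Γ₂ ⊆ A → ◇* Δ₁ ++ ¬□* Δ₂ ⊆ B → □* Γ₁ ++ □* Δ₂ ⊆ modalL gTS4 A B
  gTS4-antecedent⊆ ⊆A ⊆B = ++-⊆ (□* Γ₁)
    (map-⊆ Γ₁ _ _ (λ q → ∈-modalL-ant q (here refl)) (⊆A ∘ ∈-++⁺ˡ))
    (map-⊆ Δ₂ (λ z → ¬ □ z) _ (λ q → ∈-modalL-suc q (here refl)) (⊆B ∘ ∈-++⁺ʳ (◇* Δ₁)))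

  gTS4-succedent⊆ : □* Γ₁ ++ ¬◇* Γ₂ ⊆ A → ◇* Δ₁ ++ ¬□* Δ₂ ⊆ B → ◇* Δ₁ ++ ◇* Γ₂ ⊆ modalR gTS4 A B
  gTS4-succedent⊆ ⊆A ⊆B = ++-⊆ (◇* Δ₁)
    (map-⊆ Δ₁ _ _ (λ q → ∈-modalR-suc q (here refl)) (⊆B ∘ ∈-++⁺ˡ))
    (map-⊆ Γ₂ (λ z → ¬ ◇ z) _ (λ q → ∈-modalR-ant q (here refl)) (⊆A ∘ ∈-++⁺ʳ (□* Γ₁)))

embed : Prov L true Γ Δ → Derivable L Γ Δ
embed (set Γ≈ Δ≈ d) = weakenᴰ (embed d) (proj₁ Γ≈) (proj₁ Δ≈)
embed (ax₁ p) = zero , ax₁ (here refl) (here refl)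
embed (ax₂ p) = zero , ax₂ (here refl) (here refl)
embed (ax₃ p) = zero , ax₃ (here refl) (there (here refl))
embed (ax₄ p) = zero , ax₄ (here refl) (there (here refl))
embed (cut _ d e) =
  cut-G3 (<-wellFounded _) (embed d) (embed e) (frame ⊆-refl (∷⁺ʳ _ λ ()) ⊆-refl ⊆-refl)
embed (weL d) = weakenᴰ (embed d) there ⊆-refl
embed (weR d) = weakenᴰ (embed d) ⊆-refl there
embed (∧L d)      = by₁ (∧L (here refl)) (weakenᴰ (embed d) (∷⁺ʳ _ (∷⁺ʳ _ there)) ⊆-refl)
embed (∧R d e)    =
    by₂ (∧R (here refl)) (weakenᴰ (embed d) ⊆-refl (∷⁺ʳ _ there))
        (weakenᴰ (embed e) ⊆-refl (∷⁺ʳ _ there))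
embed (∨L d e)    =
    by₂ (∨L (here refl)) (weakenᴰ (embed d) (∷⁺ʳ _ there) ⊆-refl)
        (weakenᴰ (embed e) (∷⁺ʳ _ there) ⊆-refl)
embed (∨R d)      = by₁ (∨R (here refl)) (weakenᴰ (embed d) ⊆-refl (∷⁺ʳ _ (∷⁺ʳ _ there)))
embed (⇒L d e)    =
    by₂ (⇒L (here refl)) (weakenᴰ (embed d) there ⊆-refl)
        (weakenᴰ (embed e) (∷⁺ʳ _ there) ⊆-refl)
embed (⇒R d)      = by₁ (⇒R (here refl)) (weakenᴰ (embed d) ⊆-refl (∷⁺ʳ _ there))
embed (□L d)      = by₁ (□L (here refl)) (weakenᴰ (embed d) (∷⁺ʳ _ there) ⊆-refl)
embed (◇R d)      = by₁ (◇R (here refl)) (weakenᴰ (embed d) ⊆-refl (∷⁺ʳ _ there))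
embed (¬¬L d)     = by₁ (¬¬L (here refl)) (weakenᴰ (embed d) (∷⁺ʳ _ there) ⊆-refl)
embed (¬¬R d)     = by₁ (¬¬R (here refl)) (weakenᴰ (embed d) ⊆-refl (∷⁺ʳ _ there))
embed (¬∧L d e)   =
    by₂ (¬∧L (here refl)) (weakenᴰ (embed d) there ⊆-refl)
        (weakenᴰ (embed e) there ⊆-refl)
embed (¬∧R d)     = by₁ (¬∧R (here refl)) (weakenᴰ (embed d) ⊆-refl there)
embed (¬∨L d)     = by₁ (¬∨L (here refl)) (weakenᴰ (embed d) there ⊆-refl)
embed (¬∨R d e)   =
    by₂ (¬∨R (here refl)) (weakenᴰ (embed d) ⊆-refl there)
        (weakenᴰ (embed e) ⊆-refl there)
embed (¬⇒L d)     = by₁ (¬⇒L (here refl)) (weakenᴰ (embed d) (∷⁺ʳ _ there) ⊆-refl)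
embed (¬⇒R d e)   =
    by₂ (¬⇒R (here refl)) (weakenᴰ (embed d) ⊆-refl (∷⁺ʳ _ there))
        (weakenᴰ (embed e) ⊆-refl there)
embed (¬□R d)     = by₁ (¬□R (here refl)) (weakenᴰ (embed d) ⊆-refl there)
embed (¬◇L d)     = by₁ (¬◇L (here refl)) (weakenᴰ (embed d) there ⊆-refl)
embed (□Rˡ {Γ₁} {Γ₂} {Δ₁} {Δ₂} refl d)  = by₁ (modal □R _ (here refl))
  (weakenᴰ (embed d) (lTS4-antecedent⊆ Γ₁ Γ₂ Δ₁ Δ₂ ⊆-refl)
                    (∷⁺ʳ _ (lTS4-succedent⊆ Γ₁ Γ₂ Δ₁ Δ₂ there)))
embed (¬◇Rˡ {Γ₁} {Γ₂} {Δ₁} {Δ₂} refl d) = by₁ (modal ¬◇R _ (here refl))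
  (weakenᴰ (embed d) (∷⁺ʳ _ (lTS4-antecedent⊆ Γ₁ Γ₂ Δ₁ Δ₂ ⊆-refl))
                    (lTS4-succedent⊆ Γ₁ Γ₂ Δ₁ Δ₂ there))
embed (◇Lˡ {Γ₁} {Γ₂} {Δ₁} {Δ₂} refl d)  = by₁ (modal ◇L _ (here refl))
  (weakenᴰ (embed d) (∷⁺ʳ _ (lTS4-antecedent⊆ Γ₁ Γ₂ Δ₁ Δ₂ there))
                    (lTS4-succedent⊆ Γ₁ Γ₂ Δ₁ Δ₂ ⊆-refl))
embed (¬□Lˡ {Γ₁} {Γ₂} {Δ₁} {Δ₂} refl d) = by₁ (modal ¬□L _ (here refl))
  (weakenᴰ (embed d) (lTS4-antecedent⊆ Γ₁ Γ₂ Δ₁ Δ₂ there)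
                    (∷⁺ʳ _ (lTS4-succedent⊆ Γ₁ Γ₂ Δ₁ Δ₂ ⊆-refl)))
embed (□Rᵍ {Γ₁} {Γ₂} {Δ₁} {Δ₂} refl d)  = by₁ (modal □R _ (here refl))
  (weakenᴰ (embed d) (gTS4-antecedent⊆ Γ₁ Γ₂ Δ₁ Δ₂ ⊆-refl there)
                    (∷⁺ʳ _ (gTS4-succedent⊆ Γ₁ Γ₂ Δ₁ Δ₂ ⊆-refl there)))
embed (¬◇Rᵍ {Γ₁} {Γ₂} {Δ₁} {Δ₂} refl d) = by₁ (modal ¬◇R _ (here refl))
  (weakenᴰ (embed d) (∷⁺ʳ _ (gTS4-antecedent⊆ Γ₁ Γ₂ Δ₁ Δ₂ ⊆-refl there))
                    (gTS4-succedent⊆ Γ₁ Γ₂ Δ₁ Δ₂ ⊆-refl there))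
embed (◇Lᵍ {Γ₁} {Γ₂} {Δ₁} {Δ₂} refl d)  = by₁ (modal ◇L _ (here refl))
  (weakenᴰ (embed d) (∷⁺ʳ _ (gTS4-antecedent⊆ Γ₁ Γ₂ Δ₁ Δ₂ there ⊆-refl))
                    (gTS4-succedent⊆ Γ₁ Γ₂ Δ₁ Δ₂ there ⊆-refl))
embed (¬□Lᵍ {Γ₁} {Γ₂} {Δ₁} {Δ₂} refl d) = by₁ (modal ¬□L _ (here refl))
  (weakenᴰ (embed d) (gTS4-antecedent⊆ Γ₁ Γ₂ Δ₁ Δ₂ there ⊆-refl)
                    (∷⁺ʳ _ (gTS4-succedent⊆ Γ₁ Γ₂ Δ₁ Δ₂ there ⊆-refl)))

theorem4p4 : (L : Calc) (Γ Δ : List Fm) → Prov L true Γ Δ → Prov L false Γ Δ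
theorem4p4 L Γ Δ d = sound (proj₂ (embed d))
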